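{- Let $n\leq 5$ be a positive integer, let $N$ be the number of edges of the complete graph $K_n$, and let $\mathbb{K}$ be a field of characteristic zero. Then the algebra $A_{M(K_{n})}=\mathbb{K}[x_1,\ldots,x_N]/\mathrm{Ann}(F_{K_n})$ has the strong Lefschetz property, and $x_{1}+\cdots+x_{N}$ is a strong Lefschetz element.
   Context: For a connected graph $\Gamma$ with $N$ edges labelled $1,\dots,N$, assign the variable $x_e$ to edge $e$; the Kirchhoff polynomial is $F_\Gamma=\sum_{T}\prod_{e\in E(T)}x_e$, the sum over spanning trees $T$ of $\Gamma$. For a homogeneous $F\in\mathbb{K}[x_1,\ldots,x_N]$, $\mathrm{Ann}(F)=\{P\in\mathbb{K}[x_1,\ldots,x_N]: P(\partial/\partial x_1,\ldots,\partial/\partial x_N)F=0\}$, a homogeneous ideal; $A_{M(\Gamma)}=\mathbb{K}[x_1,\ldots,x_N]/\mathrm{Ann}(F_\Gamma)$ is a graded Artinian Gorenstein algebra. A graded Artinian algebra $A=\bigoplus_{k=0}^sA_k$ with $A_s\neq 0$ has the strong Lefschetz property if there is $L\in A_1$ such that multiplication by $L^{s-2k}$ is a bijection $A_k\to A_{s-k}$ for all $k\leq s/2$; such an $L$ is a strong Lefschetz element. -}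

module Defs where

open import Level using (_⊔_)
open import Algebra.Bundles using (CommutativeRing)
import Data.Bool
import Data.Bool.ListAction as BL
open import Data.Bool using (Bool; true; false; _∨_; _∧_; if_then_else_)
open import Data.Nat using (ℕ; zero; suc; _≤_; _<_; _≡ᵇ_)
open import Data.Fin using (Fin; toℕ) renaming (_≟_ to _≟ᶠ_)
open import Data.Vec using (Vec; []; _∷_; tabulate; zipWith; replicate; foldr; updateAt)
import Data.Vec as V
open import Data.Vec.Properties using (≡-dec)
open import Data.List using (List; []; _∷_; _++_; map; concatMap; filter; length; allFin; lookup)
import Data.List as L
open import Data.List.Relation.Unary.All using (All)
open import Data.Product using (_×_; _,_; proj₁; proj₂; Σ; Σ-syntax)
open import Relation.Nullary using (¬_; yes; no; does)
open import Relation.Binary.PropositionalEquality using (_≡_)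
import Data.Nat as N

record Field (c ℓ : Level.Level) : Set (Level.suc (c ⊔ ℓ)) where
  field
    commRing : CommutativeRing c ℓ
  open CommutativeRing commRing public
  field
    1≉0     : ¬ (1# ≈ 0#)
    inverse : ∀ x → ¬ (x ≈ 0#) → Σ[ y ∈ Carrier ] (x * y ≈ 1#)

module _ {c ℓ} (K : Field c ℓ) where
  open Field K

  ℕ→K : ℕ → Carrier
  ℕ→K zero    = 0#
  ℕ→K (suc n) = 1# + ℕ→K n

  CharZero : Set ℓ
  CharZero = ∀ m → ¬ (ℕ→K (suc m) ≈ 0#)

record Graph : Set where
  field
    V     : ℕ
    edges : List (Fin V × Fin V)
  E : ℕ
  E = length edges
  ends : Fin E → Fin V × Fin V
  ends = lookup edges

-- The complete graph K_n on vertices Fin n; edges {i,j} with i < j,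
-- listed lexicographically (this fixes the labelling 1..N of the edges).
Kn : ℕ → Graph
Kn n = record
  { V = n
  ; edges = concatMap (λ i → map (λ j → (i , j))
                         (filter (λ j → toℕ i N.<? toℕ j) (allFin n)))
                      (allFin n) }

nEdges : Graph → ℕ
nEdges G = Graph.E G

allSubsets : ∀ m → List (Vec Bool m)
allSubsets zero    = [] ∷ []
allSubsets (suc m) = map (true ∷_) (allSubsets m) ++ map (false ∷_) (allSubsets m)

countTrue : ∀ {m} → Vec Bool m → ℕ
countTrue []           = 0
countTrue (true ∷ v)   = suc (countTrue v)
countTrue (false ∷ v)  = countTrue v

module _ (G : Graph) where
  open Graph G

  eqᶠ : Fin V → Fin V → Bool
  eqᶠ a b = does (a ≟ᶠ b)

  reachStep : Vec Bool E → Vec Bool V → Vec Bool V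
  reachStep T R = tabulate λ v →
    V.lookup R v ∨
    BL.any (λ e → V.lookup T e ∧
                 ((V.lookup R (proj₁ (ends e)) ∧ eqᶠ (proj₂ (ends e)) v) ∨
                  (V.lookup R (proj₂ (ends e)) ∧ eqᶠ (proj₁ (ends e)) v)))
          (allFin E)

  iterate : ℕ → (Vec Bool V → Vec Bool V) → Vec Bool V → Vec Bool V
  iterate zero    f x = x
  iterate (suc k) f x = f (iterate k f x)

  allTrue : ∀ {m} → Vec Bool m → Bool
  allTrue = V.foldr _ _∧_ true

  -- the spanning subgraph with edge set T is connected: every vertex is
  -- reachable from vertex 0 (V steps of breadth-first search suffice)
  connectedB : Vec Bool E → Bool
  connectedB T = allTrue (iterate V (reachStep T) (tabulate λ v → toℕ v ≡ᵇ 0))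

  -- T is (the edge set of) a spanning tree: connected with V - 1 edges
  -- (equivalently: connected and acyclic)
  isSpanningTreeB : Vec Bool E → Bool
  isSpanningTreeB T = connectedB T ∧ (countTrue T ≡ᵇ (V N.∸ 1))

  spanningTrees : List (Vec Bool E)
  spanningTrees = filter (λ T → T≡ T) (allSubsets E)
    where
    T≡ : (T : Vec Bool E) → _
    T≡ T = isSpanningTreeB T Data.Bool.≟ true

-- Equality/vanishing is via
-- coefficients: p is zero iff every collected coefficient is 0 in K.

module Poly {c ℓ} (K : Field c ℓ) (N : ℕ) where
  open Field K

  Mon : Set
  Mon = Vec ℕ N

  Term : Set c
  Term = Carrier × Mon

  Pol : Set c
  Pol = List Term

  deg : Mon → ℕ
  deg = V.sum

  Homogeneous : ℕ → Pol → Set c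
  Homogeneous k p = All (λ t → deg (proj₂ t) ≡ k) p

  coeff : Pol → Mon → Carrier
  coeff []             β = 0#
  coeff ((a , α) ∷ p)  β with ≡-dec N._≟_ α β
  ... | yes _ = a + coeff p β
  ... | no  _ = coeff p β

  IsZero : Pol → Set ℓ
  IsZero p = ∀ β → coeff p β ≈ 0#

  _+ₚ_ : Pol → Pol → Pol
  p +ₚ q = p ++ q

  -ₚ_ : Pol → Pol
  -ₚ p = map (λ t → (- proj₁ t , proj₂ t)) p

  _*ₚ_ : Pol → Pol → Pol
  p *ₚ q = concatMap (λ s → map (λ t → (proj₁ s * proj₁ t , zipWith N._+_ (proj₂ s) (proj₂ t))) q) p

  oneₚ : Pol
  oneₚ = (1# , replicate N 0) ∷ []

  _^ₚ_ : Pol → ℕ → Pol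
  p ^ₚ zero  = oneₚ
  p ^ₚ suc k = p *ₚ (p ^ₚ k)

  var : Fin N → Pol
  var i = (1# , tabulate (λ j → if does (i ≟ᶠ j) then 1 else 0)) ∷ []

  sumVars : Pol
  sumVars = concatMap var (allFin N)

  -- falling factorial b (b-1) ... (b-a+1); it is 0 when a > b
  fall : ℕ → ℕ → ℕ
  fall b zero    = 1
  fall b (suc a) = (b N.∸ a) N.* fall b a

  -- (∂/∂x)^α applied to b x^β  =  b · ∏ fall(β_i, α_i) · x^(β-α)
  -- (the coefficient is 0 exactly when x^α does not divide x^β)
  actTerm : Term → Term → Term
  actTerm (a , α) (b , β) =
    (a * b * ℕ→K K (V.foldr _ N._*_ 1 (zipWith fall β α)) , zipWith N._∸_ β α)

  -- P(∂/∂x_1, …, ∂/∂x_N) F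
  act : Pol → Pol → Pol
  act P F = concatMap (λ s → map (actTerm s) F) P

  InAnn : Pol → Pol → Set ℓ
  InAnn F P = IsZero (act P F)

  -- In A = K[x]/Ann(F): s is the top degree, i.e. A_s ≠ 0 and A_k = 0 for k > s
  -- (A_k is spanned by the classes of homogeneous degree-k polynomials).
  TopDegree : Pol → ℕ → Set (c ⊔ ℓ)
  TopDegree F s =
    (Σ[ P ∈ Pol ] (Homogeneous s P × ¬ InAnn F P)) ×
    (∀ k → s < k → ∀ P → Homogeneous k P → InAnn F P)

  -- multiplication by L^m : A_k → A_(k+m) is a bijection (on classes mod Ann F)
  MultBijective : Pol → Pol → ℕ → ℕ → Set (c ⊔ ℓ)
  MultBijective F L m k =
    (∀ P Q → Homogeneous k P → Homogeneous k Q →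
       InAnn F ((L ^ₚ m) *ₚ (P +ₚ (-ₚ Q))) → InAnn F (P +ₚ (-ₚ Q))) ×
    (∀ Q → Homogeneous (k N.+ m) Q →
       Σ[ P ∈ Pol ] (Homogeneous k P × InAnn F (((L ^ₚ m) *ₚ P) +ₚ (-ₚ Q))))

  IsStrongLefschetzElement : Pol → Pol → Set (c ⊔ ℓ)
  IsStrongLefschetzElement F L =
    Homogeneous 1 L ×
    (∀ s → TopDegree F s → ∀ k → 2 N.* k ≤ s → MultBijective F L (s N.∸ 2 N.* k) k)

  HasStrongLefschetzProperty : Pol → Set (c ⊔ ℓ)
  HasStrongLefschetzProperty F = Σ[ L ∈ Pol ] IsStrongLefschetzElement F L

kirchhoff : ∀ {c ℓ} (K : Field c ℓ) (G : Graph) → Poly.Pol K (Graph.E G)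
kirchhoff K G = map (λ T → (Field.1# K , V.map (λ b → if b then 1 else 0) T)) (spanningTrees G)

module Submission where

open import Defs
open import Level using (Level)
open import Data.Nat using (ℕ; _≤_)
open import Data.Product using (_×_)
open import Data.List.Relation.Unary.All using (All)
open import Data.Nat using (_∸_)
open import Data.Product using (_,_)
open import Relation.Binary.PropositionalEquality using (_≡_; subst)

-- F = F_{Kₙ} is homogeneous of degree s = n − 1, so A = K[x]/Ann F has top degree s. Put
-- L = x₁ + ⋯ + x_N and G = L^(s−2k)(∂) F, a form of degree 2k. For P of degree k, L^(s−2k) P ∈ Ann F
-- says that the form P(∂) G of degree k vanishes, i.e. that M p = 0, where p lists the coefficients
-- of P and M_αβ is the coefficient of xᵅ in ∂ᵝ G, for monomials xᵅ, xᵝ of degree k; likewise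
-- L^(s−2k) P ≡ Q (mod Ann F) is a linear system with matrix M. So multiplication by L^(s−2k) maps
-- A_k bijectively onto A_(s−k) as soon as M is invertible. For n ≤ 5 only k = 0, k = 1 and the
-- trivial middle degree k = s/2 occur. The coefficients of F count spanning trees, so M has natural
-- entries computed from the list of spanning trees, and an integer matrix C with C M = M C = d I,
-- d ≠ 0, shows that it is invertible in characteristic zero.

module Monomials where

  open import Data.Bool using (Bool; true; false; _∧_; T; if_then_else_)
  open import Data.Bool.Properties using (T-∧; T-≡)
  open import Data.Fin as Fin using (Fin; zero; suc)
  open import Data.List using (List; []; _∷_)
  open import Data.List.Relation.Unary.All using (All; []; _∷_)
  open import Data.Nat as ℕ using (ℕ; zero; suc; _+_; _*_; _∸_; _≤_; NonZero)
  import Data.Nat.Properties as ℕₚ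
  open import Data.Product using (Σ-syntax; _,_)
  open import Data.Vec as Vec using (Vec; []; _∷_; zipWith; replicate; tabulate)
  import Data.Vec.Properties as Vecₚ
  open import Data.Vec.Relation.Binary.Pointwise.Inductive using (Pointwise; []; _∷_)
  open import Function using (Equivalence)
  open import Relation.Binary.PropositionalEquality
  open import Relation.Nullary using (does; contradiction)
  import Algebra.Properties.Semiring.Sum ℕₚ.+-*-semiring as ℕΣ
  open import Algebra.Properties.CommutativeSemigroup ℕₚ.+-commutativeSemigroup
    using () renaming (interchange to +-interchange)
  open import Algebra.Properties.CommutativeSemigroup ℕₚ.*-commutativeSemigroup
    using () renaming (interchange to *-interchange)

  private variable n : ℕ

  infixl 6 _+ᵥ_ _∸ᵥ_

  _+ᵥ_ : Vec ℕ n → Vec ℕ n → Vec ℕ n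
  _+ᵥ_ = zipWith _+_

  _∸ᵥ_ : Vec ℕ n → Vec ℕ n → Vec ℕ n
  _∸ᵥ_ = zipWith _∸_

  0ᵥ : Vec ℕ n
  0ᵥ = replicate _ 0

  deg : Vec ℕ n → ℕ
  deg = Vec.sum

  unit : Fin n → Vec ℕ n
  unit i = tabulate (λ j → if does (i Fin.≟ j) then 1 else 0)

  +ᵥ-identityˡ : (γ : Vec ℕ n) → 0ᵥ +ᵥ γ ≡ γ
  +ᵥ-identityˡ = Vecₚ.zipWith-identityˡ ℕₚ.+-identityˡ

  +ᵥ-identityʳ : (γ : Vec ℕ n) → γ +ᵥ 0ᵥ ≡ γ
  +ᵥ-identityʳ = Vecₚ.zipWith-identityʳ ℕₚ.+-identityʳ

  +ᵥ-comm : (α β : Vec ℕ n) → α +ᵥ β ≡ β +ᵥ α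
  +ᵥ-comm = Vecₚ.zipWith-comm ℕₚ.+-comm

  +ᵥ-assoc : (α β γ : Vec ℕ n) → (α +ᵥ β) +ᵥ γ ≡ α +ᵥ (β +ᵥ γ)
  +ᵥ-assoc = Vecₚ.zipWith-assoc ℕₚ.+-assoc

  +ᵥ-∸ᵥ : (γ α : Vec ℕ n) → (γ +ᵥ α) ∸ᵥ α ≡ γ
  +ᵥ-∸ᵥ []      []      = refl
  +ᵥ-∸ᵥ (x ∷ γ) (a ∷ α) = cong₂ _∷_ (ℕₚ.m+n∸n≡m x a) (+ᵥ-∸ᵥ γ α)

  ∸ᵥ-+ᵥ : {α β : Vec ℕ n} → Pointwise _≤_ α β → (β ∸ᵥ α) +ᵥ α ≡ β
  ∸ᵥ-+ᵥ []            = refl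
  ∸ᵥ-+ᵥ (a≤b ∷ α≤β) = cong₂ _∷_ (ℕₚ.m∸n+n≡m a≤b) (∸ᵥ-+ᵥ α≤β)

  deg-+ᵥ : (γ α : Vec ℕ n) → deg (γ +ᵥ α) ≡ deg γ + deg α
  deg-+ᵥ []      []      = refl
  deg-+ᵥ (x ∷ γ) (a ∷ α) =
    trans (cong (x + a +_) (deg-+ᵥ γ α)) (+-interchange x a (deg γ) (deg α))

  deg-0ᵥ : deg (0ᵥ {n}) ≡ 0
  deg-0ᵥ {zero}  = refl
  deg-0ᵥ {suc n} = deg-0ᵥ {n}

  deg≡0⇒0ᵥ : (α : Vec ℕ n) → deg α ≡ 0 → α ≡ 0ᵥ
  deg≡0⇒0ᵥ []       _  = refl
  deg≡0⇒0ᵥ (0 ∷ α) eq = cong (0 ∷_) (deg≡0⇒0ᵥ α eq)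

  tabulate-0 : tabulate {n = n} (λ _ → 0) ≡ 0ᵥ
  tabulate-0 {zero}  = refl
  tabulate-0 {suc n} = cong (0 ∷_) tabulate-0

  unit-zero : unit {suc n} zero ≡ 1 ∷ 0ᵥ
  unit-zero = cong (1 ∷_) tabulate-0

  deg-unit : (i : Fin n) → deg (unit i) ≡ 1
  deg-unit {suc n} zero    = trans (cong deg (unit-zero {n})) (cong suc (deg-0ᵥ {n}))
  deg-unit         (suc i) = deg-unit i

  deg≡1⇒unit : (α : Vec ℕ n) → deg α ≡ 1 → Σ[ i ∈ Fin n ] α ≡ unit i
  deg≡1⇒unit         (0 ∷ α)  eq with deg≡1⇒unit α eq
  ... | i , α≡eᵢ = suc i , cong (0 ∷_) α≡eᵢ
  deg≡1⇒unit {suc n} (1 ∷ α)  eq =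
    zero , trans (cong (1 ∷_) (deg≡0⇒0ᵥ α (ℕₚ.suc-injective eq))) (sym (unit-zero {n}))

  unit-injective : (i j : Fin n) → unit i ≡ unit j → i ≡ j
  unit-injective         zero    zero    _  = refl
  unit-injective {suc n} zero    (suc j) eq with trans (sym (unit-zero {n})) eq
  ... | ()
  unit-injective {suc n} (suc i) zero    eq with trans eq (unit-zero {n})
  ... | ()
  unit-injective         (suc i) (suc j) eq = cong suc (unit-injective i j (cong Vec.tail eq))

  -- rising x a = (x + 1) (x + 2) ⋯ (x + a), so that ∂ᵃ xˣ⁺ᵃ = rising x a · xˣ
  rising : ℕ → ℕ → ℕ
  rising x zero    = 1
  rising x (suc a) = suc x * rising (suc x) a

  rising-+ : ∀ x b a → rising x (b + a) ≡ rising x b * rising (x + b) a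
  rising-+ x zero    a = sym (trans (ℕₚ.+-identityʳ _) (cong (λ y → rising y a) (ℕₚ.+-identityʳ x)))
  rising-+ x (suc b) a = begin
    suc x * rising (suc x) (b + a)                      ≡⟨ cong (suc x *_) (rising-+ (suc x) b a) ⟩
    suc x * (rising (suc x) b * rising (suc x + b) a)   ≡⟨ ℕₚ.*-assoc (suc x) (rising (suc x) b) _ ⟨
    suc x * rising (suc x) b * rising (suc x + b) a     ≡⟨ cong (λ y → suc x * rising (suc x) b * rising y a) (ℕₚ.+-suc x b) ⟨
    suc x * rising (suc x) b * rising (x + suc b) a     ∎
    where open ≡-Reasoning

  rising-nonZero : ∀ x a → NonZero (rising x a)
  rising-nonZero x zero    = _
  rising-nonZero x (suc a) = ℕₚ.m*n≢0 (suc x) _ {{_}} {{rising-nonZero (suc x) a}}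

  -- the coefficient of xᵞ in ∂ᵅ xᵞ⁺ᵅ
  risingᵥ : Vec ℕ n → Vec ℕ n → ℕ
  risingᵥ γ α = Vec.foldr _ _*_ 1 (zipWith rising γ α)

  risingᵥ-+ᵥ : (γ α β : Vec ℕ n) → risingᵥ γ (α +ᵥ β) ≡ risingᵥ γ β * risingᵥ (γ +ᵥ β) α
  risingᵥ-+ᵥ []      []      []      = refl
  risingᵥ-+ᵥ (x ∷ γ) (a ∷ α) (b ∷ β) =
    trans (cong₂ _*_ (trans (cong (rising x) (ℕₚ.+-comm a b)) (rising-+ x b a)) (risingᵥ-+ᵥ γ α β))
          (*-interchange (rising x b) (rising (x + b) a) _ _)

  risingᵥ-0ᵥ : (γ : Vec ℕ n) → risingᵥ γ 0ᵥ ≡ 1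
  risingᵥ-0ᵥ []      = refl
  risingᵥ-0ᵥ (x ∷ γ) = trans (ℕₚ.+-identityʳ _) (risingᵥ-0ᵥ γ)

  risingᵥ-nonZero : (γ α : Vec ℕ n) → NonZero (risingᵥ γ α)
  risingᵥ-nonZero []      []      = _
  risingᵥ-nonZero (x ∷ γ) (a ∷ α) =
    ℕₚ.m*n≢0 (rising x a) _ {{rising-nonZero x a}} {{risingᵥ-nonZero γ α}}

  record MonomialBasis (n k r : ℕ) : Set where
    field
      monomial     : Fin r → Vec ℕ n
      deg-monomial : ∀ i → deg (monomial i) ≡ k
      injective    : ∀ i j → monomial i ≡ monomial j → i ≡ j
      complete     : ∀ α → deg α ≡ k → Σ[ i ∈ Fin r ] α ≡ monomial i

  constants : ∀ {n} → MonomialBasis n 0 1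
  constants {n} = record
    { monomial     = λ _ → 0ᵥ
    ; deg-monomial = λ _ → deg-0ᵥ {n}
    ; injective    = λ { zero zero _ → refl }
    ; complete     = λ α deg≡0 → zero , deg≡0⇒0ᵥ α deg≡0
    }

  variables : MonomialBasis n 1 n
  variables = record
    { monomial     = unit
    ; deg-monomial = deg-unit
    ; injective    = unit-injective
    ; complete     = deg≡1⇒unit
    }

  -- the coefficients of (∂₁ + ⋯ + ∂ₙ) Σ_β h β xᵝ
  ∂Σ : (Vec ℕ n → ℕ) → Vec ℕ n → ℕ
  ∂Σ h δ = ℕΣ.sum (λ i → risingᵥ δ (unit i) * h (δ +ᵥ unit i))

  ∂Σ^ : ℕ → (Vec ℕ n → ℕ) → Vec ℕ n → ℕ
  ∂Σ^ zero    h = h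
  ∂Σ^ (suc m) h = ∂Σ^ m (∂Σ h)

  -- A Boolean test rather than ≡-dec, whose evidence makes the evaluation of multiplicity in
  -- the decided instances below several times slower.
  infix 4 _≡ᵇᵥ_

  _≡ᵇᵥ_ : Vec ℕ n → Vec ℕ n → Bool
  []       ≡ᵇᵥ []       = true
  (x ∷ xs) ≡ᵇᵥ (y ∷ ys) = (x ℕ.≡ᵇ y) ∧ (xs ≡ᵇᵥ ys)

  ≡⇒≡ᵇᵥ : (α β : Vec ℕ n) → α ≡ β → T (α ≡ᵇᵥ β)
  ≡⇒≡ᵇᵥ []      []      _    = _
  ≡⇒≡ᵇᵥ (x ∷ α) (y ∷ β) α≡β =
    Equivalence.from T-∧ (ℕₚ.≡⇒≡ᵇ x y (cong Vec.head α≡β) , ≡⇒≡ᵇᵥ α β (cong Vec.tail α≡β))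

  ≡ᵇᵥ⇒≡ : (α β : Vec ℕ n) → T (α ≡ᵇᵥ β) → α ≡ β
  ≡ᵇᵥ⇒≡ []      []      _  = refl
  ≡ᵇᵥ⇒≡ (x ∷ α) (y ∷ β) eq with Equivalence.to T-∧ eq
  ... | x≡ᵇy , α≡ᵇβ = cong₂ _∷_ (ℕₚ.≡ᵇ⇒≡ x y x≡ᵇy) (≡ᵇᵥ⇒≡ α β α≡ᵇβ)

  multiplicity : List (Vec ℕ n) → Vec ℕ n → ℕ
  multiplicity []       β = 0
  multiplicity (α ∷ αs) β = if α ≡ᵇᵥ β then suc (multiplicity αs β) else multiplicity αs β

  multiplicity-vanish : ∀ {s} (αs : List (Vec ℕ n)) → All (λ α → deg α ≡ s) αs →
                        ∀ β → deg β ≢ s → multiplicity αs β ≡ 0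
  multiplicity-vanish []       []             β _      = refl
  multiplicity-vanish (α ∷ αs) (deg-α ∷ degs) β deg-β≢s with α ≡ᵇᵥ β in α≡ᵇβ
  ... | true  = contradiction (trans (cong deg (sym (≡ᵇᵥ⇒≡ α β (Equivalence.from T-≡ α≡ᵇβ)))) deg-α) deg-β≢s
  ... | false = multiplicity-vanish αs degs β deg-β≢s

open Monomials

module Certificates where

  open import Data.Bool using (if_then_else_)
  open import Data.Fin as Fin using (Fin; zero)
  import Data.Fin.Properties as Finₚ
  open import Data.Nat as ℕ using (ℕ; suc; _+_; _*_; _∸_; _≤_; NonZero)
  import Data.Nat.Properties as ℕₚ
  open import Data.Vec using (Vec; lookup)
  open import Relation.Binary.PropositionalEquality
  open import Relation.Nullary using (Dec; does)
  open import Relation.Nullary.Decidable using (True; toWitness)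
  import Algebra.Properties.Semiring.Sum ℕₚ.+-*-semiring as ℕΣ

  private variable n : ℕ

  Matrix : ℕ → Set
  Matrix r = Fin r → Fin r → ℕ

  infixl 7 _·ᴹ_
  infixl 6 _+ᴹ_
  infix 4 _≐_ _≐?_

  _·ᴹ_ : Matrix n → Matrix n → Matrix n
  (A ·ᴹ B) i j = ℕΣ.sum (λ k → A i k * B k j)

  _+ᴹ_ : Matrix n → Matrix n → Matrix n
  (A +ᴹ B) i j = A i j + B i j

  scalar : ℕ → Matrix n
  scalar D i j = if does (i Fin.≟ j) then D else 0

  _≐_ : Matrix n → Matrix n → Set
  A ≐ B = ∀ i j → A i j ≡ B i j

  _≐?_ : (A B : Matrix n) → Dec (A ≐ B)
  A ≐? B = Finₚ.all? λ i → Finₚ.all? λ j → A i j ℕ.≟ B i j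

  -- (C⁺ − C⁻) M = (1 + d) I = M (C⁺ − C⁻): an integer inverse of M up to the factor 1 + d,
  -- split into its positive and negative parts
  record InverseCertificate (M : Matrix n) : Set where
    field
      d     : ℕ
      C⁺ C⁻ : Matrix n
      left  : C⁺ ·ᴹ M ≐ C⁻ ·ᴹ M +ᴹ scalar (suc d)
      right : M ·ᴹ C⁺ ≐ M ·ᴹ C⁻ +ᴹ scalar (suc d)

  inverseCertificate : (M : Matrix n) (d : ℕ) (C⁺ C⁻ : Matrix n) →
                       {True (C⁺ ·ᴹ M ≐? C⁻ ·ᴹ M +ᴹ scalar (suc d))} →
                       {True (M ·ᴹ C⁺ ≐? M ·ᴹ C⁻ +ᴹ scalar (suc d))} →
                       InverseCertificate M
  inverseCertificate M d C⁺ C⁻ {left} {right} =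
    record { d = d ; C⁺ = C⁺ ; C⁻ = C⁻ ; left = toWitness left ; right = toWitness right }

  unitCertificate : ∀ D → .{{NonZero D}} → InverseCertificate {1} (λ _ _ → D)
  unitCertificate (suc d) = record
    { d = d ; C⁺ = λ _ _ → 1 ; C⁻ = λ _ _ → 0
    ; left  = λ { zero zero → trans (ℕₚ.+-identityʳ (1 * suc d)) (ℕₚ.*-identityˡ (suc d)) }
    ; right = λ { zero zero → trans (ℕₚ.+-identityʳ (suc d * 1))
                                    (trans (ℕₚ.*-identityʳ (suc d))
                                           (cong (_+ suc d) (sym (trans (ℕₚ.+-identityʳ (suc d * 0)) (ℕₚ.*-zeroʳ (suc d)))))) }
    }

  2*[m+n]≤o⇒2*m≤o : ∀ m n {o} → 2 * (m + n) ≤ o → 2 * m ≤ o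
  2*[m+n]≤o⇒2*m≤o m n = ℕₚ.≤-trans (ℕₚ.*-monoʳ-≤ 2 (ℕₚ.m≤m+n m n))

  -- entry (j , i) is the coefficient of x^(b j) in ∂^(b i) (∂₁ + ⋯ + ∂ₙ)ᵐ (Σ_β h β xᵝ)
  gramMatrix : ∀ {r} → ℕ → (Vec ℕ n → ℕ) → (Fin r → Vec ℕ n) → Matrix r
  gramMatrix m h b j i = risingᵥ (b j) (b i) * ∂Σ^ m h (b j +ᵥ b i)

  -- evidence that multiplication by (x₁ + ⋯ + xₙ)^(s ∸ 2k) maps A_k bijectively onto A_(s−k),
  -- where A is the algebra of a form of degree s with coefficients f
  data LefschetzEvidence (f : Vec ℕ n → ℕ) (s k : ℕ) : Set where
    middle : s ∸ 2 * k ≡ 0 → LefschetzEvidence f s k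
    gram   : ∀ {r} (B : MonomialBasis n k r) (M : Matrix r) →
             M ≐ gramMatrix (s ∸ 2 * k) f (MonomialBasis.monomial B) → InverseCertificate M →
             LefschetzEvidence f s k

  gramEvidence : ∀ {f : Vec ℕ n → ℕ} {s k r} (B : MonomialBasis n k r) (M : Matrix r) → InverseCertificate M →
                 {True (M ≐? gramMatrix (s ∸ 2 * k) f (MonomialBasis.monomial B))} → LefschetzEvidence f s k
  gramEvidence B M cert {M≐gram} = gram B M (toWitness M≐gram) cert

  k+[[s∸2k]+k]≡s : ∀ k s → 2 * k ≤ s → k + ((s ∸ 2 * k) + k) ≡ s
  k+[[s∸2k]+k]≡s k s 2k≤s = begin
    k + ((s ∸ 2 * k) + k)   ≡⟨ ℕₚ.+-comm k _ ⟩
    (s ∸ 2 * k) + k + k     ≡⟨ ℕₚ.+-assoc (s ∸ 2 * k) k k ⟩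
    (s ∸ 2 * k) + (k + k)   ≡⟨ cong (λ x → (s ∸ 2 * k) + (k + x)) (ℕₚ.+-identityʳ k) ⟨
    (s ∸ 2 * k) + 2 * k     ≡⟨ ℕₚ.m∸n+n≡m 2k≤s ⟩
    s                       ∎
    where open ≡-Reasoning

  fromRows : ∀ {r} → Vec (Vec ℕ r) r → Matrix r
  fromRows rows i j = lookup (lookup rows i) j

open Certificates

module MatrixAction {c ℓ} (K : Field c ℓ) where

  open import Data.Fin as Fin using (Fin; zero; suc)
  import Data.Fin.Properties as Finₚ
  open import Data.Nat as ℕ using (ℕ; zero; suc; NonZero)
  import Data.Nat.Properties as ℕₚ
  open import Data.Product using (_,_; proj₁; proj₂)
  open import Function using (_∘_)
  open import Relation.Binary.PropositionalEquality as ≡ using (_≡_; _≢_)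
  open import Relation.Nullary using (¬_; yes; no; contradiction)
  import Algebra.Properties.Semiring.Sum ℕₚ.+-*-semiring as ℕΣ

  open Field K hiding (zero)
  open import Algebra.Properties.Semiring.Sum semiring
  open import Algebra.Properties.Semiring.Mult semiring using (×-homo-+; ×1-homo-*) renaming (_×_ to _×ₙ_)
  open import Algebra.Properties.Ring ring using (-1*x≈-x; x[y-z]≈xy-xz)
  open import Algebra.Properties.AbelianGroup +-abelianGroup using (xyx⁻¹≈y)
  open import Algebra.Properties.CommutativeSemigroup *-commutativeSemigroup using (x∙yz≈y∙xz)
  open import Relation.Binary.Reasoning.Setoid setoid

  ⟦_⟧ : ℕ → Carrier
  ⟦_⟧ = ℕ→K K

  ≡⇒≈ : ∀ {x y} → x ≡ y → x ≈ y
  ≡⇒≈ ≡.refl = refl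

  ⟦⟧≈×1# : ∀ n → ⟦ n ⟧ ≈ n ×ₙ 1#
  ⟦⟧≈×1# zero    = refl
  ⟦⟧≈×1# (suc n) = +-congˡ (⟦⟧≈×1# n)

  ⟦+⟧ : ∀ m n → ⟦ m ℕ.+ n ⟧ ≈ ⟦ m ⟧ + ⟦ n ⟧
  ⟦+⟧ m n = trans (⟦⟧≈×1# (m ℕ.+ n)) (trans (×-homo-+ 1# m n) (sym (+-cong (⟦⟧≈×1# m) (⟦⟧≈×1# n))))

  ⟦*⟧ : ∀ m n → ⟦ m ℕ.* n ⟧ ≈ ⟦ m ⟧ * ⟦ n ⟧
  ⟦*⟧ m n = trans (⟦⟧≈×1# (m ℕ.* n)) (trans (×1-homo-* m n) (sym (*-cong (⟦⟧≈×1# m) (⟦⟧≈×1# n))))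

  ⟦1⟧ : ⟦ 1 ⟧ ≈ 1#
  ⟦1⟧ = +-identityʳ 1#

  ⟦sum⟧ : ∀ {r} (h : Fin r → ℕ) → ⟦ ℕΣ.sum h ⟧ ≈ ∑[ i < r ] ⟦ h i ⟧
  ⟦sum⟧ {zero}  h = refl
  ⟦sum⟧ {suc r} h = trans (⟦+⟧ (h zero) _) (+-congˡ (⟦sum⟧ (h ∘ suc)))

  sum-zero : ∀ {r} (h : Fin r → Carrier) → (∀ i → h i ≈ 0#) → sum h ≈ 0#
  sum-zero {r} h h≈0 = trans (sum-cong-≋ h≈0) (sum-replicate-zero r)

  sum-pick : ∀ {r} (h : Fin r → Carrier) j → (∀ i → i ≢ j → h i ≈ 0#) → sum h ≈ h j
  sum-pick {suc r} h zero    h≈0 = trans (+-congˡ (sum-zero (h ∘ suc) (λ i → h≈0 (suc i) λ ()))) (+-identityʳ _)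
  sum-pick {suc r} h (suc j) h≈0 =
    trans (+-cong (h≈0 zero λ ()) (sum-pick (h ∘ suc) j (λ i i≢j → h≈0 (suc i) (i≢j ∘ Finₚ.suc-injective))))
          (+-identityˡ _)

  x*y≈0⇒y≈0 : ∀ {x y} → ¬ (x ≈ 0#) → x * y ≈ 0# → y ≈ 0#
  x*y≈0⇒y≈0 {x} {y} x≉0 xy≈0 with inverse x x≉0
  ... | x⁻¹ , xx⁻¹≈1 = begin
    y               ≈⟨ *-identityˡ y ⟨
    1# * y          ≈⟨ *-congʳ (trans (sym xx⁻¹≈1) (*-comm x x⁻¹)) ⟩
    x⁻¹ * x * y     ≈⟨ *-assoc x⁻¹ x y ⟩
    x⁻¹ * (x * y)   ≈⟨ *-congˡ xy≈0 ⟩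
    x⁻¹ * 0#        ≈⟨ zeroʳ x⁻¹ ⟩
    0#              ∎

  ⟦⟧≉0 : CharZero K → ∀ n → .{{NonZero n}} → ¬ (⟦ n ⟧ ≈ 0#)
  ⟦⟧≉0 charZero (suc n) = charZero n

  sum-neg : ∀ {r} (h : Fin r → Carrier) → ∑[ i < r ] (- h i) ≈ - sum h
  sum-neg h = begin
    ∑[ i < _ ] (- h i)        ≈⟨ sum-cong-≋ (λ i → -1*x≈-x (h i)) ⟨
    ∑[ i < _ ] (- 1# * h i)   ≈⟨ *-distribˡ-sum (- 1#) h ⟨
    - 1# * sum h              ≈⟨ -1*x≈-x (sum h) ⟩
    - sum h                   ∎

  infixr 7 _⋆_

  _⋆_ : ∀ {r} → Matrix r → (Fin r → Carrier) → Fin r → Carrier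
  (A ⋆ v) i = ∑[ j < _ ] (⟦ A i j ⟧ * v j)

  ⋆-cong : ∀ {r} {A B : Matrix r} {u v} → A ≐ B → (∀ j → u j ≈ v j) → ∀ i → (A ⋆ u) i ≈ (B ⋆ v) i
  ⋆-cong A≐B u≈v i = sum-cong-≋ (λ j → *-cong (≡⇒≈ (≡.cong ⟦_⟧ (A≐B i j))) (u≈v j))

  ⋆-zero : ∀ {r} (A : Matrix r) v → (∀ j → v j ≈ 0#) → ∀ i → (A ⋆ v) i ≈ 0#
  ⋆-zero A v v≈0 i = sum-zero (λ j → ⟦ A i j ⟧ * v j) (λ j → trans (*-congˡ (v≈0 j)) (zeroʳ _))

  ⋆-·ᴹ : ∀ {r} (A B : Matrix r) v i → (A ⋆ B ⋆ v) i ≈ ((A ·ᴹ B) ⋆ v) i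
  ⋆-·ᴹ {r} A B v i = begin
    ∑[ j < r ] (⟦ A i j ⟧ * ∑[ k < r ] (⟦ B j k ⟧ * v k))
      ≈⟨ sum-cong-≋ (λ j → *-distribˡ-sum ⟦ A i j ⟧ (λ k → ⟦ B j k ⟧ * v k)) ⟩
    ∑[ j < r ] ∑[ k < r ] (⟦ A i j ⟧ * (⟦ B j k ⟧ * v k))
      ≈⟨ ∑-comm (λ j k → ⟦ A i j ⟧ * (⟦ B j k ⟧ * v k)) ⟩
    ∑[ k < r ] ∑[ j < r ] (⟦ A i j ⟧ * (⟦ B j k ⟧ * v k))
      ≈⟨ sum-cong-≋ (λ k → sum-cong-≋ (λ j → trans (sym (*-assoc _ _ _)) (*-congʳ (sym (⟦*⟧ (A i j) (B j k)))))) ⟩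
    ∑[ k < r ] ∑[ j < r ] (⟦ A i j ℕ.* B j k ⟧ * v k)
      ≈⟨ sum-cong-≋ (λ k → *-distribʳ-sum (v k) (λ j → ⟦ A i j ℕ.* B j k ⟧)) ⟨
    ∑[ k < r ] (∑[ j < r ] ⟦ A i j ℕ.* B j k ⟧ * v k)
      ≈⟨ sum-cong-≋ (λ k → *-congʳ (⟦sum⟧ (λ j → A i j ℕ.* B j k))) ⟨
    ∑[ k < r ] (⟦ (A ·ᴹ B) i k ⟧ * v k) ∎

  ⋆-+ᴹ : ∀ {r} (A B : Matrix r) v i → ((A +ᴹ B) ⋆ v) i ≈ (A ⋆ v) i + (B ⋆ v) i
  ⋆-+ᴹ A B v i = trans (sum-cong-≋ (λ j → trans (*-congʳ (⟦+⟧ (A i j) (B i j))) (distribʳ _ _ _)))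
                       (∑-distrib-+ (λ j → ⟦ A i j ⟧ * v j) (λ j → ⟦ B i j ⟧ * v j))

  ⋆-scalar : ∀ {r} D v (i : Fin r) → (scalar D ⋆ v) i ≈ ⟦ D ⟧ * v i
  ⋆-scalar D v i = trans (sum-pick (λ j → ⟦ scalar D i j ⟧ * v j) i off) (*-congʳ (≡⇒≈ (≡.cong ⟦_⟧ diagonal)))
    where
    off : ∀ j → j ≢ i → ⟦ scalar D i j ⟧ * v j ≈ 0#
    off j j≢i with i Fin.≟ j
    ... | yes i≡j = contradiction (≡.sym i≡j) j≢i
    ... | no _    = zeroˡ _
    diagonal : scalar D i i ≡ D
    diagonal with i Fin.≟ i
    ... | yes _   = ≡.refl
    ... | no i≢i = contradiction ≡.refl i≢i

  ⋆-scale-diff : ∀ {r} (A : Matrix r) x u w i →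
                 (A ⋆ (λ j → x * (u j - w j))) i ≈ x * ((A ⋆ u) i - (A ⋆ w) i)
  ⋆-scale-diff {r} A x u w i = begin
    ∑[ j < r ] (⟦ A i j ⟧ * (x * (u j - w j)))
      ≈⟨ sum-cong-≋ (λ j → trans (x∙yz≈y∙xz _ x _) (*-congˡ (x[y-z]≈xy-xz _ (u j) (w j)))) ⟩
    ∑[ j < r ] (x * (⟦ A i j ⟧ * u j - ⟦ A i j ⟧ * w j))
      ≈⟨ *-distribˡ-sum x (λ j → ⟦ A i j ⟧ * u j - ⟦ A i j ⟧ * w j) ⟨
    x * ∑[ j < r ] (⟦ A i j ⟧ * u j - ⟦ A i j ⟧ * w j)
      ≈⟨ *-congˡ (trans (∑-distrib-+ (λ j → ⟦ A i j ⟧ * u j) (λ j → - (⟦ A i j ⟧ * w j)))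
                        (+-congˡ (sum-neg (λ j → ⟦ A i j ⟧ * w j)))) ⟩
    x * ((A ⋆ u) i - (A ⋆ w) i) ∎

  module _ (charZero : CharZero K) {r} {M : Matrix r} (cert : InverseCertificate M) where
    open InverseCertificate cert

    private
      D : ℕ
      D = suc d

      D⁻¹ : Carrier
      D⁻¹ = proj₁ (inverse ⟦ D ⟧ (⟦⟧≉0 charZero D))

    certificate-injective : ∀ v → (∀ i → (M ⋆ v) i ≈ 0#) → ∀ i → v i ≈ 0#
    certificate-injective v Mv≈0 i = x*y≈0⇒y≈0 (⟦⟧≉0 charZero D) (begin
      ⟦ D ⟧ * v i                                    ≈⟨ +-identityˡ _ ⟨
      0# + ⟦ D ⟧ * v i                               ≈⟨ +-cong (annihilates C⁻) (⋆-scalar D v i) ⟨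
      ((C⁻ ·ᴹ M) ⋆ v) i + (scalar D ⋆ v) i           ≈⟨ ⋆-+ᴹ (C⁻ ·ᴹ M) (scalar D) v i ⟨
      ((C⁻ ·ᴹ M +ᴹ scalar D) ⋆ v) i                  ≈⟨ ⋆-cong left (λ _ → refl) i ⟨
      ((C⁺ ·ᴹ M) ⋆ v) i                              ≈⟨ annihilates C⁺ ⟩
      0#                                             ∎)
      where
      annihilates : ∀ C → ((C ·ᴹ M) ⋆ v) i ≈ 0#
      annihilates C = trans (sym (⋆-·ᴹ C M v i)) (⋆-zero C (M ⋆ v) Mv≈0 i)

    solution : (Fin r → Carrier) → Fin r → Carrier
    solution w i = D⁻¹ * ((C⁺ ⋆ w) i - (C⁻ ⋆ w) i)

    certificate-solves : ∀ w i → (M ⋆ solution w) i ≈ w i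
    certificate-solves w i = begin
      (M ⋆ solution w) i                                    ≈⟨ ⋆-scale-diff M D⁻¹ (C⁺ ⋆ w) (C⁻ ⋆ w) i ⟩
      D⁻¹ * ((M ⋆ C⁺ ⋆ w) i - (M ⋆ C⁻ ⋆ w) i)               ≈⟨ *-congˡ (+-cong (⋆-·ᴹ M C⁺ w i) (-‿cong (⋆-·ᴹ M C⁻ w i))) ⟩
      D⁻¹ * (((M ·ᴹ C⁺) ⋆ w) i - X)                         ≈⟨ *-congˡ (+-congʳ (⋆-cong right (λ _ → refl) i)) ⟩
      D⁻¹ * (((M ·ᴹ C⁻ +ᴹ scalar D) ⋆ w) i - X)             ≈⟨ *-congˡ (+-congʳ (trans (⋆-+ᴹ (M ·ᴹ C⁻) (scalar D) w i)
                                                                                       (+-congˡ (⋆-scalar D w i)))) ⟩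
      D⁻¹ * (X + ⟦ D ⟧ * w i - X)                           ≈⟨ *-congˡ (xyx⁻¹≈y X _) ⟩
      D⁻¹ * (⟦ D ⟧ * w i)                                   ≈⟨ *-assoc _ _ _ ⟨
      D⁻¹ * ⟦ D ⟧ * w i                                     ≈⟨ *-congʳ (trans (*-comm _ _) (proj₂ (inverse ⟦ D ⟧ (⟦⟧≉0 charZero D)))) ⟩
      1# * w i                                              ≈⟨ *-identityˡ _ ⟩
      w i                                                   ∎
      where
      X : Carrier
      X = ((M ·ᴹ C⁻) ⋆ w) i

module Differentiation {c ℓ} (K : Field c ℓ) {N : ℕ} where

  open import Data.Bool using (true; false; T)
  open import Data.Fin using (Fin; zero; suc)
  open import Data.List as List using (List; []; _∷_; _++_)
  open import Data.List.Relation.Unary.All as All using (All; []; _∷_)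
  import Data.List.Relation.Unary.All.Properties as Allₚ
  open import Data.Nat as ℕ using (ℕ; zero; suc)
  import Data.Nat.Properties as ℕₚ
  open import Data.Product using (Σ-syntax; _,_; proj₁; proj₂)
  open import Data.Sum using (_⊎_; inj₁; inj₂)
  open import Data.Vec as Vec using (Vec; []; _∷_; zipWith)
  open import Data.Vec.Properties using (≡-dec)
  open import Data.Vec.Relation.Binary.Pointwise.Inductive as Pointwise using (Pointwise; []; _∷_)
  open import Function using (_∘_)
  open import Relation.Binary.PropositionalEquality as ≡ using (_≡_; _≢_)
  open import Relation.Nullary using (¬_; yes; no; contradiction)

  open Field K hiding (zero)
  open MatrixAction K
  open Poly K N hiding (deg)
  open import Algebra.Properties.Semiring.Sum semiring
  open import Algebra.Properties.Ring ring using (-‿distribˡ-*; -0#≈0#)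
  open import Algebra.Properties.AbelianGroup +-abelianGroup using (⁻¹-∙-comm)
  open import Algebra.Properties.CommutativeSemigroup *-commutativeSemigroup using (x∙yz≈y∙xz; xy∙z≈y∙xz)
  open import Algebra.Properties.CommutativeSemigroup +-commutativeSemigroup
    using () renaming (interchange to +-interchange)
  open import Relation.Binary.Reasoning.Setoid setoid

  coeff-≡ : ∀ a α p β → α ≡ β → coeff ((a , α) ∷ p) β ≈ a + coeff p β
  coeff-≡ a α p β α≡β with ≡-dec ℕ._≟_ α β
  ... | yes _   = refl
  ... | no α≢β = contradiction α≡β α≢β

  coeff-≢ : ∀ a α p β → α ≢ β → coeff ((a , α) ∷ p) β ≈ coeff p β
  coeff-≢ a α p β α≢β with ≡-dec ℕ._≟_ α β
  ... | yes α≡β = contradiction α≡β α≢β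
  ... | no _    = refl

  coeff-skip : ∀ a α p β → α ≢ β ⊎ a ≈ 0# → coeff ((a , α) ∷ p) β ≈ coeff p β
  coeff-skip a α p β (inj₁ α≢β) = coeff-≢ a α p β α≢β
  coeff-skip a α p β (inj₂ a≈0) with ≡-dec ℕ._≟_ α β
  ... | yes _ = trans (+-congʳ a≈0) (+-identityˡ _)
  ... | no _  = refl

  coeff-++ : ∀ p q β → coeff (p ++ q) β ≈ coeff p β + coeff q β
  coeff-++ []            q β = sym (+-identityˡ _)
  coeff-++ ((a , α) ∷ p) q β with ≡-dec ℕ._≟_ α β
  ... | yes _ = trans (+-congˡ (coeff-++ p q β)) (sym (+-assoc _ _ _))
  ... | no _  = coeff-++ p q β

  fall-+ : ∀ x a → fall (x ℕ.+ a) a ≡ rising x a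
  fall-+ x zero    = ≡.refl
  fall-+ x (suc a) = ≡.trans (≡.cong (λ b → fall b (suc a)) (ℕₚ.+-suc x a))
                             (≡.cong₂ ℕ._*_ (ℕₚ.m+n∸n≡m (suc x) a) (fall-+ (suc x) a))

  fall-< : ∀ {b a} → b ℕ.< a → fall b a ≡ 0
  fall-< {b} {suc a} (ℕ.s≤s b≤a) = ≡.cong (ℕ._* fall b a) (ℕₚ.m≤n⇒m∸n≡0 b≤a)

  fallingᵥ : Mon → Mon → ℕ
  fallingᵥ β α = Vec.foldr _ ℕ._*_ 1 (zipWith fall β α)

  fallingᵥ-+ᵥ : (γ α : Mon) → fallingᵥ (γ +ᵥ α) α ≡ risingᵥ γ α
  fallingᵥ-+ᵥ γ α = go γ α
    where
    go : ∀ {n} (γ α : Vec ℕ n) → Vec.foldr _ ℕ._*_ 1 (zipWith fall (γ +ᵥ α) α) ≡ risingᵥ γ α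
    go []      []      = ≡.refl
    go (x ∷ γ) (a ∷ α) = ≡.cong₂ ℕ._*_ (fall-+ x a) (go γ α)

  fallingᵥ-≰ : (β α : Mon) → ¬ Pointwise ℕ._≤_ α β → fallingᵥ β α ≡ 0
  fallingᵥ-≰ β α = go β α
    where
    go : ∀ {n} (β α : Vec ℕ n) → ¬ Pointwise ℕ._≤_ α β → Vec.foldr _ ℕ._*_ 1 (zipWith fall β α) ≡ 0
    go []      []      α≰β = contradiction [] α≰β
    go (b ∷ β) (a ∷ α) α≰β with a ℕ.≤? b
    ... | no a≰b  = ≡.cong (ℕ._* _) (fall-< (ℕₚ.≰⇒> a≰b))
    ... | yes a≤b = ≡.trans (≡.cong (fall b a ℕ.*_) (go β α (α≰β ∘ (a≤b ∷_)))) (ℕₚ.*-zeroʳ (fall b a))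

  -- ∂ α h γ is the coefficient of xᵞ in ∂ᵅ (Σ_β h β xᵝ), and apply P h are the coefficients of
  -- P(∂₁, …, ∂_N) (Σ_β h β xᵝ)
  ∂ : Mon → (Mon → Carrier) → Mon → Carrier
  ∂ α h γ = ⟦ risingᵥ γ α ⟧ * h (γ +ᵥ α)

  apply : Pol → (Mon → Carrier) → Mon → Carrier
  apply []            h γ = 0#
  apply ((a , α) ∷ P) h γ = a * ∂ α h γ + apply P h γ

  coeff-actTerm : ∀ a α H γ → coeff (List.map (actTerm (a , α)) H) γ ≈ a * ∂ α (coeff H) γ
  coeff-actTerm a α []            γ = sym (trans (*-congˡ (zeroʳ _)) (zeroʳ a))
  coeff-actTerm a α ((b , β) ∷ H) γ with ≡-dec ℕ._≟_ (γ +ᵥ α) β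
  ... | yes ≡.refl = begin
    coeff ((a * b * ⟦ fallingᵥ (γ +ᵥ α) α ⟧ , (γ +ᵥ α) ∸ᵥ α) ∷ List.map (actTerm (a , α)) H) γ
      ≈⟨ coeff-≡ _ _ _ γ (+ᵥ-∸ᵥ γ α) ⟩
    a * b * ⟦ fallingᵥ (γ +ᵥ α) α ⟧ + coeff (List.map (actTerm (a , α)) H) γ
      ≈⟨ +-cong (*-congˡ (≡⇒≈ (≡.cong ⟦_⟧ (fallingᵥ-+ᵥ γ α)))) (coeff-actTerm a α H γ) ⟩
    a * b * R + a * (R * coeff H (γ +ᵥ α))
      ≈⟨ +-congʳ (trans (*-assoc a b R) (*-congˡ (*-comm b R))) ⟩
    a * (R * b) + a * (R * coeff H (γ +ᵥ α))
      ≈⟨ distribˡ a _ _ ⟨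
    a * (R * b + R * coeff H (γ +ᵥ α))
      ≈⟨ *-congˡ (distribˡ R b _) ⟨
    a * (R * (b + coeff H (γ +ᵥ α)))
      ≈⟨ *-congˡ (*-congˡ (coeff-≡ b _ H _ ≡.refl)) ⟨
    a * ∂ α (coeff ((b , γ +ᵥ α) ∷ H)) γ ∎
    where
    R : Carrier
    R = ⟦ risingᵥ γ α ⟧
  ... | no γ+α≢β = trans (coeff-skip _ (β ∸ᵥ α) _ γ skip)
                   (trans (coeff-actTerm a α H γ) (*-congˡ (*-congˡ (sym (coeff-≢ b β H _ (γ+α≢β ∘ ≡.sym))))))
    where
    skip : β ∸ᵥ α ≢ γ ⊎ a * b * ⟦ fallingᵥ β α ⟧ ≈ 0#
    skip with Pointwise.decidable ℕ._≤?_ α β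
    ... | yes α≤β = inj₁ (λ β∸α≡γ → γ+α≢β (≡.trans (≡.cong (_+ᵥ α) (≡.sym β∸α≡γ)) (∸ᵥ-+ᵥ α≤β)))
    ... | no α≰β  = inj₂ (trans (*-congˡ (≡⇒≈ (≡.cong ⟦_⟧ (fallingᵥ-≰ β α α≰β)))) (zeroʳ _))

  coeff-act : ∀ P H γ → coeff (act P H) γ ≈ apply P (coeff H) γ
  coeff-act []            H γ = refl
  coeff-act ((a , α) ∷ P) H γ =
    trans (coeff-++ (List.map (actTerm (a , α)) H) (act P H) γ) (+-cong (coeff-actTerm a α H γ) (coeff-act P H γ))

  ∂-cong : ∀ α {h h′} → (∀ δ → h δ ≈ h′ δ) → ∀ γ → ∂ α h γ ≈ ∂ α h′ γ
  ∂-cong α h≈h′ γ = *-congˡ (h≈h′ (γ +ᵥ α))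

  ∂-+ᵥ : ∀ α β h γ → ∂ (α +ᵥ β) h γ ≈ ∂ β (∂ α h) γ
  ∂-+ᵥ α β h γ = begin
    ⟦ risingᵥ γ (α +ᵥ β) ⟧ * h (γ +ᵥ (α +ᵥ β))
      ≈⟨ *-cong (≡⇒≈ (≡.cong ⟦_⟧ (risingᵥ-+ᵥ γ α β))) (≡⇒≈ (≡.cong h γ+[α+β]≡[γ+β]+α)) ⟩
    ⟦ risingᵥ γ β ℕ.* risingᵥ (γ +ᵥ β) α ⟧ * h ((γ +ᵥ β) +ᵥ α)
      ≈⟨ *-congʳ (⟦*⟧ (risingᵥ γ β) _) ⟩
    ⟦ risingᵥ γ β ⟧ * ⟦ risingᵥ (γ +ᵥ β) α ⟧ * h ((γ +ᵥ β) +ᵥ α)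
      ≈⟨ *-assoc _ _ _ ⟩
    ⟦ risingᵥ γ β ⟧ * ∂ α h (γ +ᵥ β) ∎
    where
    γ+[α+β]≡[γ+β]+α : γ +ᵥ (α +ᵥ β) ≡ (γ +ᵥ β) +ᵥ α
    γ+[α+β]≡[γ+β]+α = ≡.trans (≡.cong (γ +ᵥ_) (+ᵥ-comm α β)) (≡.sym (+ᵥ-assoc γ β α))

  apply-+ₚ : ∀ P Q h γ → apply (P +ₚ Q) h γ ≈ apply P h γ + apply Q h γ
  apply-+ₚ []            Q h γ = sym (+-identityˡ _)
  apply-+ₚ ((a , α) ∷ P) Q h γ = trans (+-congˡ (apply-+ₚ P Q h γ)) (sym (+-assoc _ _ _))

  apply--ₚ : ∀ Q h γ → apply (-ₚ Q) h γ ≈ - apply Q h γ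
  apply--ₚ []            h γ = sym -0#≈0#
  apply--ₚ ((a , α) ∷ Q) h γ = trans (+-cong (sym (-‿distribˡ-* a _)) (apply--ₚ Q h γ)) (⁻¹-∙-comm _ _)

  apply-cong : ∀ P {h h′} → (∀ δ → h δ ≈ h′ δ) → ∀ γ → apply P h γ ≈ apply P h′ γ
  apply-cong []            h≈h′ γ = refl
  apply-cong ((a , α) ∷ P) h≈h′ γ = +-cong (*-congˡ (∂-cong α h≈h′ γ)) (apply-cong P h≈h′ γ)

  apply-0 : ∀ P h γ → (∀ δ → h δ ≈ 0#) → apply P h γ ≈ 0#
  apply-0 []            h γ h≈0 = refl
  apply-0 ((a , α) ∷ P) h γ h≈0 =
    trans (+-cong (trans (*-congˡ (trans (*-congˡ (h≈0 _)) (zeroʳ _))) (zeroʳ a)) (apply-0 P h γ h≈0))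
          (+-identityʳ 0#)

  apply-+ : ∀ P h h′ γ → apply P (λ δ → h δ + h′ δ) γ ≈ apply P h γ + apply P h′ γ
  apply-+ []            h h′ γ = sym (+-identityˡ _)
  apply-+ ((a , α) ∷ P) h h′ γ =
    trans (+-cong (trans (*-congˡ (distribˡ _ _ _)) (distribˡ _ _ _)) (apply-+ P h h′ γ)) (+-interchange _ _ _ _)

  apply-oneₚ : ∀ h γ → apply oneₚ h γ ≈ h γ
  apply-oneₚ h γ = begin
    1# * (⟦ risingᵥ γ 0ᵥ ⟧ * h (γ +ᵥ 0ᵥ)) + 0# ≈⟨ +-identityʳ _ ⟩
    1# * (⟦ risingᵥ γ 0ᵥ ⟧ * h (γ +ᵥ 0ᵥ))      ≈⟨ *-identityˡ _ ⟩
    ⟦ risingᵥ γ 0ᵥ ⟧ * h (γ +ᵥ 0ᵥ)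
      ≈⟨ *-cong (trans (≡⇒≈ (≡.cong ⟦_⟧ (risingᵥ-0ᵥ γ))) ⟦1⟧) (≡⇒≈ (≡.cong h (+ᵥ-identityʳ γ))) ⟩
    1# * h γ                                   ≈⟨ *-identityˡ _ ⟩
    h γ                                        ∎

  -- multiplying P by a monomial a xᵅ composes the operator P(∂) with a ∂ᵅ
  apply-shift : ∀ a α B h γ →
    apply (List.map (λ t → (a * proj₁ t , α +ᵥ proj₂ t)) B) h γ ≈ apply B (λ δ → a * ∂ α h δ) γ
  apply-shift a α []            h γ = refl
  apply-shift a α ((b , β) ∷ B) h γ = +-cong term (apply-shift a α B h γ)
    where
    term : a * b * ∂ (α +ᵥ β) h γ ≈ b * ∂ β (λ δ → a * ∂ α h δ) γ
    term = begin
      a * b * ∂ (α +ᵥ β) h γ        ≈⟨ *-congˡ (∂-+ᵥ α β h γ) ⟩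
      a * b * ∂ β (∂ α h) γ         ≈⟨ xy∙z≈y∙xz a b _ ⟩
      b * (a * ∂ β (∂ α h) γ)       ≈⟨ *-congˡ (x∙yz≈y∙xz a _ _) ⟩
      b * ∂ β (λ δ → a * ∂ α h δ) γ ∎

  apply-*ₚ : ∀ A B h γ → apply (A *ₚ B) h γ ≈ apply B (apply A h) γ
  apply-*ₚ []            B h γ = sym (apply-0 B (λ _ → 0#) γ (λ _ → refl))
  apply-*ₚ ((a , α) ∷ A) B h γ = begin
    apply (shifted ++ (A *ₚ B)) h γ                                ≈⟨ apply-+ₚ shifted (A *ₚ B) h γ ⟩
    apply shifted h γ + apply (A *ₚ B) h γ                         ≈⟨ +-cong (apply-shift a α B h γ) (apply-*ₚ A B h γ) ⟩
    apply B (λ δ → a * ∂ α h δ) γ + apply B (apply A h) γ          ≈⟨ apply-+ B _ (apply A h) γ ⟨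
    apply B (apply ((a , α) ∷ A) h) γ                              ∎
    where
    shifted : Pol
    shifted = List.map (λ t → (a * proj₁ t , α +ᵥ proj₂ t)) B

  Homogeneous-+ₚ : ∀ {k P Q} → Homogeneous k P → Homogeneous k Q → Homogeneous k (P +ₚ Q)
  Homogeneous-+ₚ = Allₚ.++⁺

  Homogeneous--ₚ : ∀ {k Q} → Homogeneous k Q → Homogeneous k (-ₚ Q)
  Homogeneous--ₚ = Allₚ.map⁺

  Homogeneous-*ₚ : ∀ {a b A B} → Homogeneous a A → Homogeneous b B → Homogeneous (a ℕ.+ b) (A *ₚ B)
  Homogeneous-*ₚ {B = B} homA homB =
    Allₚ.concat⁺ (Allₚ.map⁺ (All.map (λ {s} deg-s → Allₚ.map⁺ (All.map
      (λ {t} deg-t → ≡.trans (deg-+ᵥ (proj₂ s) (proj₂ t)) (≡.cong₂ ℕ._+_ deg-s deg-t)) homB)) homA))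

  Homogeneous-^ₚ : ∀ {L} → Homogeneous 1 L → ∀ m → Homogeneous m (L ^ₚ m)
  Homogeneous-^ₚ homL zero    = deg-0ᵥ {N} ∷ []
  Homogeneous-^ₚ homL (suc m) = Homogeneous-*ₚ homL (Homogeneous-^ₚ homL m)

  linearCombination : ∀ {r} → (Fin r → Carrier) → (Fin r → Mon) → Pol
  linearCombination c b = List.concatMap (λ i → (c i , b i) ∷ []) (List.allFin _)

  Homogeneous-linearCombination : ∀ {k r} c (b : Fin r → Mon) → (∀ i → deg (b i) ≡ k) →
                                  Homogeneous k (linearCombination c b)
  Homogeneous-linearCombination c b deg-b = Allₚ.concat⁺ (Allₚ.map⁺ (Allₚ.tabulate⁺ (λ i → deg-b i ∷ [])))

  apply-linearCombination : ∀ {r} c (b : Fin r → Mon) h γ →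
                            apply (linearCombination c b) h γ ≈ ∑[ i < r ] (c i * ∂ (b i) h γ)
  apply-linearCombination c b h γ = go (λ i → i)
    where
    go : ∀ {m} (g : Fin m → Fin _) →
         apply (List.concatMap (λ i → (c i , b i) ∷ []) (List.tabulate g)) h γ ≈ ∑[ i < m ] (c (g i) * ∂ (b (g i)) h γ)
    go {zero}  g = refl
    go {suc m} g = +-congˡ (go (g ∘ suc))

  apply-basis : ∀ {k r} (B : MonomialBasis N k r) → let open MonomialBasis B in
                ∀ R h γ → Homogeneous k R → apply R h γ ≈ ∑[ i < r ] (coeff R (monomial i) * ∂ (monomial i) h γ)
  apply-basis {r = r} B [] h γ [] = sym (sum-zero {r} (λ i → 0# * ∂ (monomial i) h γ) (λ i → zeroˡ _))
    where open MonomialBasis B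
  apply-basis {r = r} B ((a , α) ∷ R) h γ (deg-α ∷ homR) with MonomialBasis.complete B α deg-α
  ... | j , ≡.refl = sym (begin
    ∑[ i < r ] (coeff ((a , α) ∷ R) (b i) * X i)
      ≈⟨ sum-cong-≋ (λ i → trans (*-congʳ (coeff-++ ((a , α) ∷ []) R (b i))) (distribʳ _ _ _)) ⟩
    ∑[ i < r ] (coeff ((a , α) ∷ []) (b i) * X i + coeff R (b i) * X i)
      ≈⟨ ∑-distrib-+ (λ i → coeff ((a , α) ∷ []) (b i) * X i) _ ⟩
    ∑[ i < r ] (coeff ((a , α) ∷ []) (b i) * X i) + ∑[ i < r ] (coeff R (b i) * X i)
      ≈⟨ +-cong (sum-pick _ j off) (sym (apply-basis B R h γ homR)) ⟩
    coeff ((a , α) ∷ []) α * X j + apply R h γ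
      ≈⟨ +-congʳ (*-congʳ (trans (coeff-≡ a α [] α ≡.refl) (+-identityʳ a))) ⟩
    a * ∂ α h γ + apply R h γ ∎)
    where
    open MonomialBasis B renaming (monomial to b)
    X : Fin r → Carrier
    X i = ∂ (b i) h γ
    off : ∀ i → i ≢ j → coeff ((a , α) ∷ []) (b i) * X i ≈ 0#
    off i i≢j = trans (*-congʳ (coeff-≢ a α [] (b i) (i≢j ∘ ≡.sym ∘ injective j i))) (zeroˡ _)

  apply-vanish : ∀ {d k} P h γ → (∀ β → deg β ≢ d → h β ≈ 0#) → Homogeneous k P → deg γ ℕ.+ k ≢ d →
                 apply P h γ ≈ 0#
  apply-vanish []            h γ h≈0 []              _  = refl
  apply-vanish ((a , α) ∷ P) h γ h≈0 (deg-α ∷ homP) ≢d =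
    trans (+-cong (trans (*-congˡ (trans (*-congˡ (h≈0 _ off)) (zeroʳ _))) (zeroʳ a)) (apply-vanish P h γ h≈0 homP ≢d))
          (+-identityʳ 0#)
    where
    off : deg (γ +ᵥ α) ≢ _
    off eq = ≢d (≡.trans (≡.trans (≡.cong (deg γ ℕ.+_) (≡.sym deg-α)) (≡.sym (deg-+ᵥ γ α))) eq)

  ∂-⟦⟧ : ∀ (h : Mon → Carrier) (f : Mon → ℕ) → (∀ δ → h δ ≈ ⟦ f δ ⟧) → ∀ α γ → ∂ α h γ ≈ ⟦ risingᵥ γ α ℕ.* f (γ +ᵥ α) ⟧
  ∂-⟦⟧ h f h≈f α γ = trans (*-congˡ (h≈f (γ +ᵥ α))) (sym (⟦*⟧ (risingᵥ γ α) (f (γ +ᵥ α))))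

  Homogeneous-sumVars : Homogeneous 1 sumVars
  Homogeneous-sumVars = Homogeneous-linearCombination (λ _ → 1#) unit deg-unit

  apply-sumVars : ∀ (h : Mon → Carrier) (f : Mon → ℕ) → (∀ δ → h δ ≈ ⟦ f δ ⟧) → ∀ δ → apply sumVars h δ ≈ ⟦ ∂Σ f δ ⟧
  apply-sumVars h f h≈f δ = begin
    apply sumVars h δ                                     ≈⟨ apply-linearCombination (λ _ → 1#) unit h δ ⟩
    ∑[ i < N ] (1# * ∂ (unit i) h δ)                      ≈⟨ sum-cong-≋ (λ i → trans (*-identityˡ _) (∂-⟦⟧ h f h≈f (unit i) δ)) ⟩
    ∑[ i < N ] ⟦ risingᵥ δ (unit i) ℕ.* f (δ +ᵥ unit i) ⟧ ≈⟨ ⟦sum⟧ (λ i → risingᵥ δ (unit i) ℕ.* f (δ +ᵥ unit i)) ⟨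
    ⟦ ∂Σ f δ ⟧                                            ∎

  apply-sumVars^ : ∀ m (h : Mon → Carrier) (f : Mon → ℕ) → (∀ δ → h δ ≈ ⟦ f δ ⟧) → ∀ δ → apply (sumVars ^ₚ m) h δ ≈ ⟦ ∂Σ^ m f δ ⟧
  apply-sumVars^ zero    h f h≈f δ = trans (apply-oneₚ h δ) (h≈f δ)
  apply-sumVars^ (suc m) h f h≈f δ =
    trans (apply-*ₚ sumVars (sumVars ^ₚ m) h δ) (apply-sumVars^ m (apply sumVars h) (∂Σ f) (apply-sumVars h f h≈f) δ)

  coeff-monomials : ∀ {A : Set} (e : A → Mon) xs β →
                    coeff (List.map (λ x → (1# , e x)) xs) β ≈ ⟦ multiplicity (List.map e xs) β ⟧
  coeff-monomials e []       β = refl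
  coeff-monomials e (x ∷ xs) β with ≡-dec ℕ._≟_ (e x) β | e x ≡ᵇᵥ β in ex≡ᵇβ
  ... | yes _    | true  = +-congˡ (coeff-monomials e xs β)
  ... | no _     | false = coeff-monomials e xs β
  ... | yes ex≡β | false = contradiction (≡⇒≡ᵇᵥ (e x) β ex≡β) (λ t → ≡.subst T ex≡ᵇβ t)
  ... | no ex≢β  | true  = contradiction (≡ᵇᵥ⇒≡ (e x) β (≡.subst T (≡.sym ex≡ᵇβ) _)) ex≢β

module Lefschetz {c ℓ} (K : Field c ℓ) where

  open import Data.Fin using (Fin)
  open import Data.List using ([]; _∷_)
  open import Data.List.Relation.Unary.All using ([]; _∷_)
  open import Data.Nat as ℕ using (ℕ; _∸_; _≤_; NonZero) renaming (_*_ to _ℕ*_)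
  import Data.Nat.Properties as ℕₚ
  open import Data.Product using (Σ-syntax; _×_; _,_)
  open import Data.Vec using (Vec)
  open import Relation.Binary.Definitions using (tri<; tri≈; tri>)
  open import Relation.Binary.PropositionalEquality as ≡ using (_≡_; _≢_)
  open import Relation.Nullary using (¬_; yes; no; contradiction)

  open MatrixAction K
  open Differentiation K
  open Field K hiding (zero)
  open import Algebra.Properties.Semiring.Sum semiring using (sum-syntax; sum-cong-≋)
  open import Relation.Binary.Reasoning.Setoid setoid

  module _ {N : ℕ} (F : Poly.Pol K N) where
    open Poly K N hiding (deg)

    apply⇒multBijective : ∀ L m k → let g = apply (L ^ₚ m) (coeff F) in
      (∀ R → Homogeneous k R → (∀ γ → apply R g γ ≈ 0#) → ∀ γ → apply R (coeff F) γ ≈ 0#) →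
      (∀ Q → Homogeneous (k ℕ.+ m) Q →
         Σ[ P ∈ Pol ] Homogeneous k P × (∀ γ → apply P g γ ≈ apply Q (coeff F) γ)) →
      MultBijective F L m k
    apply⇒multBijective L m k injective surjective = inj , surj
      where
      inj : ∀ P Q → Homogeneous k P → Homogeneous k Q →
            InAnn F ((L ^ₚ m) *ₚ (P +ₚ (-ₚ Q))) → InAnn F (P +ₚ (-ₚ Q))
      inj P Q homP homQ ann γ = trans (coeff-act R F γ) (injective R (Homogeneous-+ₚ homP (Homogeneous--ₚ homQ)) g-ann γ)
        where
        R : Pol
        R = P +ₚ (-ₚ Q)
        g-ann : ∀ γ → apply R (apply (L ^ₚ m) (coeff F)) γ ≈ 0#
        g-ann γ = trans (sym (apply-*ₚ (L ^ₚ m) R (coeff F) γ)) (trans (sym (coeff-act ((L ^ₚ m) *ₚ R) F γ)) (ann γ))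
      surj : ∀ Q → Homogeneous (k ℕ.+ m) Q → Σ[ P ∈ Pol ] Homogeneous k P × InAnn F (((L ^ₚ m) *ₚ P) +ₚ (-ₚ Q))
      surj Q homQ with surjective Q homQ
      ... | P , homP , P≈Q = P , homP , λ γ → begin
        coeff (act (((L ^ₚ m) *ₚ P) +ₚ (-ₚ Q)) F) γ                  ≈⟨ coeff-act (((L ^ₚ m) *ₚ P) +ₚ (-ₚ Q)) F γ ⟩
        apply (((L ^ₚ m) *ₚ P) +ₚ (-ₚ Q)) (coeff F) γ                ≈⟨ apply-+ₚ ((L ^ₚ m) *ₚ P) (-ₚ Q) (coeff F) γ ⟩
        apply ((L ^ₚ m) *ₚ P) (coeff F) γ + apply (-ₚ Q) (coeff F) γ ≈⟨ +-cong (apply-*ₚ (L ^ₚ m) P (coeff F) γ) (apply--ₚ Q (coeff F) γ) ⟩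
        apply P (apply (L ^ₚ m) (coeff F)) γ - apply Q (coeff F) γ   ≈⟨ +-congʳ (P≈Q γ) ⟩
        apply Q (coeff F) γ - apply Q (coeff F) γ                    ≈⟨ -‿inverseʳ _ ⟩
        0#                                                           ∎

    multBijective-pow0 : ∀ L k → MultBijective F L 0 k
    multBijective-pow0 L k = apply⇒multBijective L 0 k
      (λ R _ R-ann γ → trans (sym (apply-cong R (apply-oneₚ (coeff F)) γ)) (R-ann γ))
      (λ Q homQ → Q , ≡.subst (λ k → Homogeneous k Q) (ℕₚ.+-identityʳ k) homQ , apply-cong Q (apply-oneₚ (coeff F)))

    module _ {s : ℕ} (F-homogeneous : ∀ β → deg β ≢ s → coeff F β ≈ 0#) where

      multBijective-gram : ∀ {L k m r} → Homogeneous 1 L → k ℕ.+ (m ℕ.+ k) ≡ s →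
        (B : MonomialBasis N k r) → let open MonomialBasis B in
        (M : Matrix r) → InverseCertificate M → CharZero K →
        (∀ j i → ∂ (monomial i) (apply (L ^ₚ m) (coeff F)) (monomial j) ≈ ⟦ M j i ⟧) →
        MultBijective F L m k
      multBijective-gram {L} {k} {m} {r} homL k+m+k≡s B M cert charZero pairing =
        apply⇒multBijective L m k injectivity surjectivity
        where
        open MonomialBasis B renaming (monomial to b)
        g : Mon → Carrier
        g = apply (L ^ₚ m) (coeff F)

        pairing-sum : ∀ (v : Fin r → Carrier) j → ∑[ i < r ] (v i * ∂ (b i) g (b j)) ≈ (M ⋆ v) j
        pairing-sum v j = sum-cong-≋ (λ i → trans (*-comm _ _) (*-congʳ (pairing j i)))

        injectivity : ∀ R → Homogeneous k R → (∀ γ → apply R g γ ≈ 0#) → ∀ γ → apply R (coeff F) γ ≈ 0#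
        injectivity R homR R-ann γ = trans (apply-basis B R (coeff F) γ homR)
          (sum-zero _ (λ i → trans (*-congʳ (R≈0 i)) (zeroˡ _)))
          where
          R≈0 : ∀ i → coeff R (b i) ≈ 0#
          R≈0 = certificate-injective charZero cert _ (λ j → trans (sym (trans (apply-basis B R g (b j) homR) (pairing-sum _ j))) (R-ann (b j)))

        surjectivity : ∀ Q → Homogeneous (k ℕ.+ m) Q →
                       Σ[ P ∈ Pol ] Homogeneous k P × (∀ γ → apply P g γ ≈ apply Q (coeff F) γ)
        surjectivity Q homQ = P , homP , P≈Q
          where
          p : Fin r → Carrier
          p = solution charZero cert (λ j → apply Q (coeff F) (b j))
          P : Pol
          P = linearCombination p b
          homP : Homogeneous k P
          homP = Homogeneous-linearCombination p b deg-monomial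
          P≈Q : ∀ γ → apply P g γ ≈ apply Q (coeff F) γ
          P≈Q γ with deg γ ℕ.≟ k
          ... | yes deg-γ with complete γ deg-γ
          ...   | j , ≡.refl = begin
            apply P g (b j)                      ≈⟨ apply-linearCombination p b g (b j) ⟩
            ∑[ i < r ] (p i * ∂ (b i) g (b j))   ≈⟨ pairing-sum p j ⟩
            (M ⋆ p) j                            ≈⟨ certificate-solves charZero cert _ j ⟩
            apply Q (coeff F) (b j)              ∎
          P≈Q γ | no deg-γ≢k = trans (sym (apply-*ₚ (L ^ₚ m) P (coeff F) γ))
            (trans (apply-vanish _ (coeff F) γ F-homogeneous (Homogeneous-*ₚ (Homogeneous-^ₚ homL m) homP) (off (ℕₚ.+-comm m k)))
                   (sym (apply-vanish Q (coeff F) γ F-homogeneous homQ (off ≡.refl))))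
            where
            off : ∀ {e} → e ≡ k ℕ.+ m → deg γ ℕ.+ e ≢ s
            off ≡.refl eq = deg-γ≢k (ℕₚ.+-cancelʳ-≡ (k ℕ.+ m) (deg γ) k
              (≡.trans eq (≡.trans (≡.sym k+m+k≡s) (≡.cong (k ℕ.+_) (ℕₚ.+-comm m k)))))

      topDegree≡ : CharZero K → ∀ β₀ → deg β₀ ≡ s → ¬ coeff F β₀ ≈ 0# → ∀ t → TopDegree F t → t ≡ s
      topDegree≡ charZero β₀ deg-β₀ F-β₀≉0 t ((P , homP , P∉Ann) , top) with ℕₚ.<-cmp t s
      ... | tri≈ _ t≡s _ = t≡s
      ... | tri< t<s _ _ = contradiction (top s t<s xᵝ⁰ (deg-β₀ ∷ []) 0ᵥ) xᵝ⁰∉Ann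
        where
        xᵝ⁰ : Pol
        xᵝ⁰ = (1# , β₀) ∷ []
        xᵝ⁰∉Ann : ¬ coeff (act xᵝ⁰ F) 0ᵥ ≈ 0#
        xᵝ⁰∉Ann ann = F-β₀≉0 (begin
          coeff F β₀                                      ≈⟨ ≡⇒≈ (≡.cong (coeff F) (+ᵥ-identityˡ β₀)) ⟨
          coeff F (0ᵥ +ᵥ β₀)                              ≈⟨ x*y≈0⇒y≈0 (⟦⟧≉0 charZero _ {{risingᵥ-nonZero 0ᵥ β₀}}) ∂ᵝ⁰F≈0 ⟩
          0#                                              ∎)
          where
          ∂ᵝ⁰F≈0 : ∂ β₀ (coeff F) 0ᵥ ≈ 0#
          ∂ᵝ⁰F≈0 = trans (sym (trans (+-identityʳ _) (*-identityˡ _))) (trans (sym (coeff-act xᵝ⁰ F 0ᵥ)) ann)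
      ... | tri> _ _ s<t = contradiction (λ γ → trans (coeff-act P F γ) (apply-vanish P (coeff F) γ F-homogeneous homP (off γ))) P∉Ann
        where
        off : ∀ γ → deg γ ℕ.+ t ≢ s
        off γ eq = ℕₚ.<⇒≱ s<t (≡.subst (t ≤_) eq (ℕₚ.m≤n+m t (deg γ)))

      isStrongLefschetzElement : CharZero K → ∀ β₀ → deg β₀ ≡ s → ¬ coeff F β₀ ≈ 0# →
        ∀ L → Homogeneous 1 L → (∀ k → 2 ℕ* k ≤ s → MultBijective F L (s ∸ 2 ℕ* k) k) →
        IsStrongLefschetzElement F L
      isStrongLefschetzElement charZero β₀ deg-β₀ F-β₀≉0 L homL bijective = homL , bijective′
        where
        bijective′ : ∀ t → TopDegree F t → ∀ k → 2 ℕ* k ≤ t → MultBijective F L (t ∸ 2 ℕ* k) k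
        bijective′ t top with topDegree≡ charZero β₀ deg-β₀ F-β₀≉0 t top
        ... | ≡.refl = bijective

  module NaturalCoefficients (charZero : CharZero K) {N s : ℕ} (F : Poly.Pol K N) (f : Vec ℕ N → ℕ)
                             (F≈f : ∀ β → Poly.coeff K N F β ≈ ⟦ f β ⟧)
                             (f-homogeneous : ∀ β → deg β ≢ s → f β ≡ 0) where
    open Poly K N hiding (deg)

    F-homogeneous : ∀ β → deg β ≢ s → coeff F β ≈ 0#
    F-homogeneous β deg-β≢s = trans (F≈f β) (≡⇒≈ (≡.cong ⟦_⟧ (f-homogeneous β deg-β≢s)))

    sumVars-multBijective : ∀ {k m r} → k ℕ.+ (m ℕ.+ k) ≡ s → (B : MonomialBasis N k r) (M : Matrix r) →
                            M ≐ gramMatrix m f (MonomialBasis.monomial B) → InverseCertificate M →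
                            MultBijective F sumVars m k
    sumVars-multBijective {m = m} k+m+k≡s B M M≐gram cert =
      multBijective-gram F F-homogeneous Homogeneous-sumVars k+m+k≡s B M cert charZero pairing
      where
      open MonomialBasis B renaming (monomial to b)
      pairing : ∀ j i → ∂ (b i) (apply (sumVars ^ₚ m) (coeff F)) (b j) ≈ ⟦ M j i ⟧
      pairing j i = trans (∂-⟦⟧ _ (∂Σ^ m f) (apply-sumVars^ m (coeff F) f F≈f) (b i) (b j))
                       (≡⇒≈ (≡.cong ⟦_⟧ (≡.sym (M≐gram j i))))

    multBijective-evidence : ∀ k → 2 ℕ* k ≤ s → LefschetzEvidence f s k → MultBijective F sumVars (s ∸ 2 ℕ* k) k
    multBijective-evidence k _ (middle s∸2k≡0) =
      ≡.subst (λ m → MultBijective F sumVars m k) (≡.sym s∸2k≡0) (multBijective-pow0 F sumVars k)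
    multBijective-evidence k 2k≤s (gram B M M≐gram cert) =
      sumVars-multBijective (k+[[s∸2k]+k]≡s k s 2k≤s) B M M≐gram cert

    sumVars-isStrongLefschetzElement : ∀ β₀ → .{{NonZero (f β₀)}} →
      (∀ k → 2 ℕ* k ≤ s → LefschetzEvidence f s k) → IsStrongLefschetzElement F sumVars
    sumVars-isStrongLefschetzElement β₀ evidence =
      isStrongLefschetzElement F F-homogeneous charZero β₀ deg-β₀ F-β₀≉0 sumVars Homogeneous-sumVars
        (λ k 2k≤s → multBijective-evidence k 2k≤s (evidence k 2k≤s))
      where
      F-β₀≉0 : ¬ coeff F β₀ ≈ 0#
      F-β₀≉0 F-β₀≈0 = ⟦⟧≉0 charZero (f β₀) (trans (sym (F≈f β₀)) F-β₀≈0)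
      deg-β₀ : deg β₀ ≡ s
      deg-β₀ with deg β₀ ℕ.≟ s
      ... | yes deg-β₀≡s = deg-β₀≡s
      ... | no deg-β₀≢s = contradiction (F-homogeneous β₀ deg-β₀≢s) F-β₀≉0

module SpanningTrees where

  open import Data.Bool using (Bool; true; false; if_then_else_)
  open import Data.Bool.Properties using (T-∧; T-≡)
  open import Data.List as List using (List)
  open import Data.List.Relation.Unary.All as All using (All)
  import Data.List.Relation.Unary.All.Properties as Allₚ
  open import Data.Nat as ℕ using (ℕ; suc; _∸_; _≤_; NonZero)
  import Data.Nat.Properties as ℕₚ
  open import Data.Product using (proj₂)
  open import Data.Vec as Vec using (Vec; []; _∷_)
  open import Function using (Equivalence)
  open import Relation.Binary.PropositionalEquality

  indicator : ∀ {m} → Vec Bool m → Vec ℕ m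
  indicator = Vec.map (λ b → if b then 1 else 0)

  spanningTreeExponents : (G : Graph) → List (Vec ℕ (nEdges G))
  spanningTreeExponents G = List.map indicator (spanningTrees G)

  deg-indicator : ∀ {m} (T : Vec Bool m) → deg (indicator T) ≡ countTrue T
  deg-indicator []          = refl
  deg-indicator (true ∷ T)  = cong suc (deg-indicator T)
  deg-indicator (false ∷ T) = deg-indicator T

  spanningTreeExponents-deg : ∀ G → All (λ α → deg α ≡ Graph.V G ∸ 1) (spanningTreeExponents G)
  spanningTreeExponents-deg G = Allₚ.map⁺ (All.map (λ {T} → edgeCount {T}) (Allₚ.all-filter _ (allSubsets (nEdges G))))
    where
    edgeCount : ∀ {T} → isSpanningTreeB G T ≡ true → deg (indicator T) ≡ Graph.V G ∸ 1
    edgeCount {T} tree = trans (deg-indicator T)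
      (ℕₚ.≡ᵇ⇒≡ _ _ (proj₂ (Equivalence.to T-∧ (Equivalence.from T-≡ tree))))

  record KirchhoffCertificate (G : Graph) : Set where
    field
      trees            : List (Vec ℕ (nEdges G))
      trees-correct    : spanningTreeExponents G ≡ trees
      tree             : Vec ℕ (nEdges G)
      .{{tree-counted}} : NonZero (multiplicity trees tree)
      evidence         : ∀ k → 2 ℕ.* k ≤ Graph.V G ∸ 1 → LefschetzEvidence (multiplicity trees) (Graph.V G ∸ 1) k

open SpanningTrees

module CompleteGraphs where

  open import Data.List using (List; []; _∷_)
  open import Data.Nat using (ℕ; suc; _≤_; s≤s)
  open import Data.Vec using (Vec; []; _∷_)
  open import Relation.Binary.PropositionalEquality using (refl)
  open import Relation.Nullary using (contradiction)

  K₁-trees : List (Vec ℕ (nEdges (Kn 1)))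
  K₁-trees =
    [] ∷ []

  K₂-trees : List (Vec ℕ (nEdges (Kn 2)))
  K₂-trees =
    (1 ∷ []) ∷ []

  K₃-trees : List (Vec ℕ (nEdges (Kn 3)))
  K₃-trees =
    (1 ∷ 1 ∷ 0 ∷ []) ∷
    (1 ∷ 0 ∷ 1 ∷ []) ∷
    (0 ∷ 1 ∷ 1 ∷ []) ∷ []

  K₄-trees : List (Vec ℕ (nEdges (Kn 4)))
  K₄-trees =
    (1 ∷ 1 ∷ 1 ∷ 0 ∷ 0 ∷ 0 ∷ []) ∷
    (1 ∷ 1 ∷ 0 ∷ 0 ∷ 1 ∷ 0 ∷ []) ∷
    (1 ∷ 1 ∷ 0 ∷ 0 ∷ 0 ∷ 1 ∷ []) ∷
    (1 ∷ 0 ∷ 1 ∷ 1 ∷ 0 ∷ 0 ∷ []) ∷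
    (1 ∷ 0 ∷ 1 ∷ 0 ∷ 0 ∷ 1 ∷ []) ∷
    (1 ∷ 0 ∷ 0 ∷ 1 ∷ 1 ∷ 0 ∷ []) ∷
    (1 ∷ 0 ∷ 0 ∷ 1 ∷ 0 ∷ 1 ∷ []) ∷
    (1 ∷ 0 ∷ 0 ∷ 0 ∷ 1 ∷ 1 ∷ []) ∷
    (0 ∷ 1 ∷ 1 ∷ 1 ∷ 0 ∷ 0 ∷ []) ∷
    (0 ∷ 1 ∷ 1 ∷ 0 ∷ 1 ∷ 0 ∷ []) ∷
    (0 ∷ 1 ∷ 0 ∷ 1 ∷ 1 ∷ 0 ∷ []) ∷
    (0 ∷ 1 ∷ 0 ∷ 1 ∷ 0 ∷ 1 ∷ []) ∷
    (0 ∷ 1 ∷ 0 ∷ 0 ∷ 1 ∷ 1 ∷ []) ∷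
    (0 ∷ 0 ∷ 1 ∷ 1 ∷ 1 ∷ 0 ∷ []) ∷
    (0 ∷ 0 ∷ 1 ∷ 1 ∷ 0 ∷ 1 ∷ []) ∷
    (0 ∷ 0 ∷ 1 ∷ 0 ∷ 1 ∷ 1 ∷ []) ∷ []

  K₅-trees : List (Vec ℕ (nEdges (Kn 5)))
  K₅-trees =
    (1 ∷ 1 ∷ 1 ∷ 1 ∷ 0 ∷ 0 ∷ 0 ∷ 0 ∷ 0 ∷ 0 ∷ []) ∷
    (1 ∷ 1 ∷ 1 ∷ 0 ∷ 0 ∷ 0 ∷ 1 ∷ 0 ∷ 0 ∷ 0 ∷ []) ∷
    (1 ∷ 1 ∷ 1 ∷ 0 ∷ 0 ∷ 0 ∷ 0 ∷ 0 ∷ 1 ∷ 0 ∷ []) ∷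
    (1 ∷ 1 ∷ 1 ∷ 0 ∷ 0 ∷ 0 ∷ 0 ∷ 0 ∷ 0 ∷ 1 ∷ []) ∷
    (1 ∷ 1 ∷ 0 ∷ 1 ∷ 0 ∷ 1 ∷ 0 ∷ 0 ∷ 0 ∷ 0 ∷ []) ∷
    (1 ∷ 1 ∷ 0 ∷ 1 ∷ 0 ∷ 0 ∷ 0 ∷ 1 ∷ 0 ∷ 0 ∷ []) ∷
    (1 ∷ 1 ∷ 0 ∷ 1 ∷ 0 ∷ 0 ∷ 0 ∷ 0 ∷ 0 ∷ 1 ∷ []) ∷
    (1 ∷ 1 ∷ 0 ∷ 0 ∷ 0 ∷ 1 ∷ 1 ∷ 0 ∷ 0 ∷ 0 ∷ []) ∷
    (1 ∷ 1 ∷ 0 ∷ 0 ∷ 0 ∷ 1 ∷ 0 ∷ 0 ∷ 1 ∷ 0 ∷ []) ∷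
    (1 ∷ 1 ∷ 0 ∷ 0 ∷ 0 ∷ 1 ∷ 0 ∷ 0 ∷ 0 ∷ 1 ∷ []) ∷
    (1 ∷ 1 ∷ 0 ∷ 0 ∷ 0 ∷ 0 ∷ 1 ∷ 1 ∷ 0 ∷ 0 ∷ []) ∷
    (1 ∷ 1 ∷ 0 ∷ 0 ∷ 0 ∷ 0 ∷ 1 ∷ 0 ∷ 0 ∷ 1 ∷ []) ∷
    (1 ∷ 1 ∷ 0 ∷ 0 ∷ 0 ∷ 0 ∷ 0 ∷ 1 ∷ 1 ∷ 0 ∷ []) ∷
    (1 ∷ 1 ∷ 0 ∷ 0 ∷ 0 ∷ 0 ∷ 0 ∷ 1 ∷ 0 ∷ 1 ∷ []) ∷
    (1 ∷ 1 ∷ 0 ∷ 0 ∷ 0 ∷ 0 ∷ 0 ∷ 0 ∷ 1 ∷ 1 ∷ []) ∷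
    (1 ∷ 0 ∷ 1 ∷ 1 ∷ 1 ∷ 0 ∷ 0 ∷ 0 ∷ 0 ∷ 0 ∷ []) ∷
    (1 ∷ 0 ∷ 1 ∷ 1 ∷ 0 ∷ 0 ∷ 0 ∷ 1 ∷ 0 ∷ 0 ∷ []) ∷
    (1 ∷ 0 ∷ 1 ∷ 1 ∷ 0 ∷ 0 ∷ 0 ∷ 0 ∷ 1 ∷ 0 ∷ []) ∷
    (1 ∷ 0 ∷ 1 ∷ 0 ∷ 1 ∷ 0 ∷ 1 ∷ 0 ∷ 0 ∷ 0 ∷ []) ∷
    (1 ∷ 0 ∷ 1 ∷ 0 ∷ 1 ∷ 0 ∷ 0 ∷ 0 ∷ 1 ∷ 0 ∷ []) ∷
    (1 ∷ 0 ∷ 1 ∷ 0 ∷ 1 ∷ 0 ∷ 0 ∷ 0 ∷ 0 ∷ 1 ∷ []) ∷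
    (1 ∷ 0 ∷ 1 ∷ 0 ∷ 0 ∷ 0 ∷ 1 ∷ 1 ∷ 0 ∷ 0 ∷ []) ∷
    (1 ∷ 0 ∷ 1 ∷ 0 ∷ 0 ∷ 0 ∷ 1 ∷ 0 ∷ 1 ∷ 0 ∷ []) ∷
    (1 ∷ 0 ∷ 1 ∷ 0 ∷ 0 ∷ 0 ∷ 0 ∷ 1 ∷ 1 ∷ 0 ∷ []) ∷
    (1 ∷ 0 ∷ 1 ∷ 0 ∷ 0 ∷ 0 ∷ 0 ∷ 1 ∷ 0 ∷ 1 ∷ []) ∷
    (1 ∷ 0 ∷ 1 ∷ 0 ∷ 0 ∷ 0 ∷ 0 ∷ 0 ∷ 1 ∷ 1 ∷ []) ∷
    (1 ∷ 0 ∷ 0 ∷ 1 ∷ 1 ∷ 1 ∷ 0 ∷ 0 ∷ 0 ∷ 0 ∷ []) ∷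
    (1 ∷ 0 ∷ 0 ∷ 1 ∷ 1 ∷ 0 ∷ 0 ∷ 1 ∷ 0 ∷ 0 ∷ []) ∷
    (1 ∷ 0 ∷ 0 ∷ 1 ∷ 1 ∷ 0 ∷ 0 ∷ 0 ∷ 0 ∷ 1 ∷ []) ∷
    (1 ∷ 0 ∷ 0 ∷ 1 ∷ 0 ∷ 1 ∷ 0 ∷ 1 ∷ 0 ∷ 0 ∷ []) ∷
    (1 ∷ 0 ∷ 0 ∷ 1 ∷ 0 ∷ 1 ∷ 0 ∷ 0 ∷ 1 ∷ 0 ∷ []) ∷
    (1 ∷ 0 ∷ 0 ∷ 1 ∷ 0 ∷ 0 ∷ 0 ∷ 1 ∷ 1 ∷ 0 ∷ []) ∷
    (1 ∷ 0 ∷ 0 ∷ 1 ∷ 0 ∷ 0 ∷ 0 ∷ 1 ∷ 0 ∷ 1 ∷ []) ∷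
    (1 ∷ 0 ∷ 0 ∷ 1 ∷ 0 ∷ 0 ∷ 0 ∷ 0 ∷ 1 ∷ 1 ∷ []) ∷
    (1 ∷ 0 ∷ 0 ∷ 0 ∷ 1 ∷ 1 ∷ 1 ∷ 0 ∷ 0 ∷ 0 ∷ []) ∷
    (1 ∷ 0 ∷ 0 ∷ 0 ∷ 1 ∷ 1 ∷ 0 ∷ 0 ∷ 1 ∷ 0 ∷ []) ∷
    (1 ∷ 0 ∷ 0 ∷ 0 ∷ 1 ∷ 1 ∷ 0 ∷ 0 ∷ 0 ∷ 1 ∷ []) ∷
    (1 ∷ 0 ∷ 0 ∷ 0 ∷ 1 ∷ 0 ∷ 1 ∷ 1 ∷ 0 ∷ 0 ∷ []) ∷
    (1 ∷ 0 ∷ 0 ∷ 0 ∷ 1 ∷ 0 ∷ 1 ∷ 0 ∷ 0 ∷ 1 ∷ []) ∷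
    (1 ∷ 0 ∷ 0 ∷ 0 ∷ 1 ∷ 0 ∷ 0 ∷ 1 ∷ 1 ∷ 0 ∷ []) ∷
    (1 ∷ 0 ∷ 0 ∷ 0 ∷ 1 ∷ 0 ∷ 0 ∷ 1 ∷ 0 ∷ 1 ∷ []) ∷
    (1 ∷ 0 ∷ 0 ∷ 0 ∷ 1 ∷ 0 ∷ 0 ∷ 0 ∷ 1 ∷ 1 ∷ []) ∷
    (1 ∷ 0 ∷ 0 ∷ 0 ∷ 0 ∷ 1 ∷ 1 ∷ 1 ∷ 0 ∷ 0 ∷ []) ∷
    (1 ∷ 0 ∷ 0 ∷ 0 ∷ 0 ∷ 1 ∷ 1 ∷ 0 ∷ 1 ∷ 0 ∷ []) ∷
    (1 ∷ 0 ∷ 0 ∷ 0 ∷ 0 ∷ 1 ∷ 0 ∷ 1 ∷ 1 ∷ 0 ∷ []) ∷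
    (1 ∷ 0 ∷ 0 ∷ 0 ∷ 0 ∷ 1 ∷ 0 ∷ 1 ∷ 0 ∷ 1 ∷ []) ∷
    (1 ∷ 0 ∷ 0 ∷ 0 ∷ 0 ∷ 1 ∷ 0 ∷ 0 ∷ 1 ∷ 1 ∷ []) ∷
    (1 ∷ 0 ∷ 0 ∷ 0 ∷ 0 ∷ 0 ∷ 1 ∷ 1 ∷ 1 ∷ 0 ∷ []) ∷
    (1 ∷ 0 ∷ 0 ∷ 0 ∷ 0 ∷ 0 ∷ 1 ∷ 1 ∷ 0 ∷ 1 ∷ []) ∷
    (1 ∷ 0 ∷ 0 ∷ 0 ∷ 0 ∷ 0 ∷ 1 ∷ 0 ∷ 1 ∷ 1 ∷ []) ∷
    (0 ∷ 1 ∷ 1 ∷ 1 ∷ 1 ∷ 0 ∷ 0 ∷ 0 ∷ 0 ∷ 0 ∷ []) ∷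
    (0 ∷ 1 ∷ 1 ∷ 1 ∷ 0 ∷ 1 ∷ 0 ∷ 0 ∷ 0 ∷ 0 ∷ []) ∷
    (0 ∷ 1 ∷ 1 ∷ 1 ∷ 0 ∷ 0 ∷ 1 ∷ 0 ∷ 0 ∷ 0 ∷ []) ∷
    (0 ∷ 1 ∷ 1 ∷ 0 ∷ 1 ∷ 0 ∷ 1 ∷ 0 ∷ 0 ∷ 0 ∷ []) ∷
    (0 ∷ 1 ∷ 1 ∷ 0 ∷ 1 ∷ 0 ∷ 0 ∷ 0 ∷ 1 ∷ 0 ∷ []) ∷
    (0 ∷ 1 ∷ 1 ∷ 0 ∷ 1 ∷ 0 ∷ 0 ∷ 0 ∷ 0 ∷ 1 ∷ []) ∷
    (0 ∷ 1 ∷ 1 ∷ 0 ∷ 0 ∷ 1 ∷ 1 ∷ 0 ∷ 0 ∷ 0 ∷ []) ∷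
    (0 ∷ 1 ∷ 1 ∷ 0 ∷ 0 ∷ 1 ∷ 0 ∷ 0 ∷ 1 ∷ 0 ∷ []) ∷
    (0 ∷ 1 ∷ 1 ∷ 0 ∷ 0 ∷ 1 ∷ 0 ∷ 0 ∷ 0 ∷ 1 ∷ []) ∷
    (0 ∷ 1 ∷ 1 ∷ 0 ∷ 0 ∷ 0 ∷ 1 ∷ 0 ∷ 1 ∷ 0 ∷ []) ∷
    (0 ∷ 1 ∷ 1 ∷ 0 ∷ 0 ∷ 0 ∷ 1 ∷ 0 ∷ 0 ∷ 1 ∷ []) ∷
    (0 ∷ 1 ∷ 0 ∷ 1 ∷ 1 ∷ 1 ∷ 0 ∷ 0 ∷ 0 ∷ 0 ∷ []) ∷
    (0 ∷ 1 ∷ 0 ∷ 1 ∷ 1 ∷ 0 ∷ 0 ∷ 1 ∷ 0 ∷ 0 ∷ []) ∷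
    (0 ∷ 1 ∷ 0 ∷ 1 ∷ 1 ∷ 0 ∷ 0 ∷ 0 ∷ 0 ∷ 1 ∷ []) ∷
    (0 ∷ 1 ∷ 0 ∷ 1 ∷ 0 ∷ 1 ∷ 1 ∷ 0 ∷ 0 ∷ 0 ∷ []) ∷
    (0 ∷ 1 ∷ 0 ∷ 1 ∷ 0 ∷ 1 ∷ 0 ∷ 1 ∷ 0 ∷ 0 ∷ []) ∷
    (0 ∷ 1 ∷ 0 ∷ 1 ∷ 0 ∷ 1 ∷ 0 ∷ 0 ∷ 0 ∷ 1 ∷ []) ∷
    (0 ∷ 1 ∷ 0 ∷ 1 ∷ 0 ∷ 0 ∷ 1 ∷ 1 ∷ 0 ∷ 0 ∷ []) ∷
    (0 ∷ 1 ∷ 0 ∷ 1 ∷ 0 ∷ 0 ∷ 1 ∷ 0 ∷ 0 ∷ 1 ∷ []) ∷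
    (0 ∷ 1 ∷ 0 ∷ 0 ∷ 1 ∷ 1 ∷ 1 ∷ 0 ∷ 0 ∷ 0 ∷ []) ∷
    (0 ∷ 1 ∷ 0 ∷ 0 ∷ 1 ∷ 1 ∷ 0 ∷ 0 ∷ 1 ∷ 0 ∷ []) ∷
    (0 ∷ 1 ∷ 0 ∷ 0 ∷ 1 ∷ 1 ∷ 0 ∷ 0 ∷ 0 ∷ 1 ∷ []) ∷
    (0 ∷ 1 ∷ 0 ∷ 0 ∷ 1 ∷ 0 ∷ 1 ∷ 1 ∷ 0 ∷ 0 ∷ []) ∷
    (0 ∷ 1 ∷ 0 ∷ 0 ∷ 1 ∷ 0 ∷ 1 ∷ 0 ∷ 0 ∷ 1 ∷ []) ∷
    (0 ∷ 1 ∷ 0 ∷ 0 ∷ 1 ∷ 0 ∷ 0 ∷ 1 ∷ 1 ∷ 0 ∷ []) ∷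
    (0 ∷ 1 ∷ 0 ∷ 0 ∷ 1 ∷ 0 ∷ 0 ∷ 1 ∷ 0 ∷ 1 ∷ []) ∷
    (0 ∷ 1 ∷ 0 ∷ 0 ∷ 1 ∷ 0 ∷ 0 ∷ 0 ∷ 1 ∷ 1 ∷ []) ∷
    (0 ∷ 1 ∷ 0 ∷ 0 ∷ 0 ∷ 1 ∷ 1 ∷ 1 ∷ 0 ∷ 0 ∷ []) ∷
    (0 ∷ 1 ∷ 0 ∷ 0 ∷ 0 ∷ 1 ∷ 1 ∷ 0 ∷ 1 ∷ 0 ∷ []) ∷
    (0 ∷ 1 ∷ 0 ∷ 0 ∷ 0 ∷ 1 ∷ 0 ∷ 1 ∷ 1 ∷ 0 ∷ []) ∷
    (0 ∷ 1 ∷ 0 ∷ 0 ∷ 0 ∷ 1 ∷ 0 ∷ 1 ∷ 0 ∷ 1 ∷ []) ∷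
    (0 ∷ 1 ∷ 0 ∷ 0 ∷ 0 ∷ 1 ∷ 0 ∷ 0 ∷ 1 ∷ 1 ∷ []) ∷
    (0 ∷ 1 ∷ 0 ∷ 0 ∷ 0 ∷ 0 ∷ 1 ∷ 1 ∷ 1 ∷ 0 ∷ []) ∷
    (0 ∷ 1 ∷ 0 ∷ 0 ∷ 0 ∷ 0 ∷ 1 ∷ 1 ∷ 0 ∷ 1 ∷ []) ∷
    (0 ∷ 1 ∷ 0 ∷ 0 ∷ 0 ∷ 0 ∷ 1 ∷ 0 ∷ 1 ∷ 1 ∷ []) ∷
    (0 ∷ 0 ∷ 1 ∷ 1 ∷ 1 ∷ 1 ∷ 0 ∷ 0 ∷ 0 ∷ 0 ∷ []) ∷
    (0 ∷ 0 ∷ 1 ∷ 1 ∷ 1 ∷ 0 ∷ 1 ∷ 0 ∷ 0 ∷ 0 ∷ []) ∷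
    (0 ∷ 0 ∷ 1 ∷ 1 ∷ 1 ∷ 0 ∷ 0 ∷ 1 ∷ 0 ∷ 0 ∷ []) ∷
    (0 ∷ 0 ∷ 1 ∷ 1 ∷ 1 ∷ 0 ∷ 0 ∷ 0 ∷ 1 ∷ 0 ∷ []) ∷
    (0 ∷ 0 ∷ 1 ∷ 1 ∷ 0 ∷ 1 ∷ 0 ∷ 1 ∷ 0 ∷ 0 ∷ []) ∷
    (0 ∷ 0 ∷ 1 ∷ 1 ∷ 0 ∷ 1 ∷ 0 ∷ 0 ∷ 1 ∷ 0 ∷ []) ∷
    (0 ∷ 0 ∷ 1 ∷ 1 ∷ 0 ∷ 0 ∷ 1 ∷ 1 ∷ 0 ∷ 0 ∷ []) ∷
    (0 ∷ 0 ∷ 1 ∷ 1 ∷ 0 ∷ 0 ∷ 1 ∷ 0 ∷ 1 ∷ 0 ∷ []) ∷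
    (0 ∷ 0 ∷ 1 ∷ 0 ∷ 1 ∷ 1 ∷ 1 ∷ 0 ∷ 0 ∷ 0 ∷ []) ∷
    (0 ∷ 0 ∷ 1 ∷ 0 ∷ 1 ∷ 1 ∷ 0 ∷ 0 ∷ 1 ∷ 0 ∷ []) ∷
    (0 ∷ 0 ∷ 1 ∷ 0 ∷ 1 ∷ 1 ∷ 0 ∷ 0 ∷ 0 ∷ 1 ∷ []) ∷
    (0 ∷ 0 ∷ 1 ∷ 0 ∷ 1 ∷ 0 ∷ 1 ∷ 1 ∷ 0 ∷ 0 ∷ []) ∷
    (0 ∷ 0 ∷ 1 ∷ 0 ∷ 1 ∷ 0 ∷ 1 ∷ 0 ∷ 0 ∷ 1 ∷ []) ∷
    (0 ∷ 0 ∷ 1 ∷ 0 ∷ 1 ∷ 0 ∷ 0 ∷ 1 ∷ 1 ∷ 0 ∷ []) ∷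
    (0 ∷ 0 ∷ 1 ∷ 0 ∷ 1 ∷ 0 ∷ 0 ∷ 1 ∷ 0 ∷ 1 ∷ []) ∷
    (0 ∷ 0 ∷ 1 ∷ 0 ∷ 1 ∷ 0 ∷ 0 ∷ 0 ∷ 1 ∷ 1 ∷ []) ∷
    (0 ∷ 0 ∷ 1 ∷ 0 ∷ 0 ∷ 1 ∷ 1 ∷ 1 ∷ 0 ∷ 0 ∷ []) ∷
    (0 ∷ 0 ∷ 1 ∷ 0 ∷ 0 ∷ 1 ∷ 1 ∷ 0 ∷ 1 ∷ 0 ∷ []) ∷
    (0 ∷ 0 ∷ 1 ∷ 0 ∷ 0 ∷ 1 ∷ 0 ∷ 1 ∷ 1 ∷ 0 ∷ []) ∷
    (0 ∷ 0 ∷ 1 ∷ 0 ∷ 0 ∷ 1 ∷ 0 ∷ 1 ∷ 0 ∷ 1 ∷ []) ∷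
    (0 ∷ 0 ∷ 1 ∷ 0 ∷ 0 ∷ 1 ∷ 0 ∷ 0 ∷ 1 ∷ 1 ∷ []) ∷
    (0 ∷ 0 ∷ 1 ∷ 0 ∷ 0 ∷ 0 ∷ 1 ∷ 1 ∷ 1 ∷ 0 ∷ []) ∷
    (0 ∷ 0 ∷ 1 ∷ 0 ∷ 0 ∷ 0 ∷ 1 ∷ 1 ∷ 0 ∷ 1 ∷ []) ∷
    (0 ∷ 0 ∷ 1 ∷ 0 ∷ 0 ∷ 0 ∷ 1 ∷ 0 ∷ 1 ∷ 1 ∷ []) ∷
    (0 ∷ 0 ∷ 0 ∷ 1 ∷ 1 ∷ 1 ∷ 1 ∷ 0 ∷ 0 ∷ 0 ∷ []) ∷
    (0 ∷ 0 ∷ 0 ∷ 1 ∷ 1 ∷ 1 ∷ 0 ∷ 0 ∷ 1 ∷ 0 ∷ []) ∷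
    (0 ∷ 0 ∷ 0 ∷ 1 ∷ 1 ∷ 1 ∷ 0 ∷ 0 ∷ 0 ∷ 1 ∷ []) ∷
    (0 ∷ 0 ∷ 0 ∷ 1 ∷ 1 ∷ 0 ∷ 1 ∷ 1 ∷ 0 ∷ 0 ∷ []) ∷
    (0 ∷ 0 ∷ 0 ∷ 1 ∷ 1 ∷ 0 ∷ 1 ∷ 0 ∷ 0 ∷ 1 ∷ []) ∷
    (0 ∷ 0 ∷ 0 ∷ 1 ∷ 1 ∷ 0 ∷ 0 ∷ 1 ∷ 1 ∷ 0 ∷ []) ∷
    (0 ∷ 0 ∷ 0 ∷ 1 ∷ 1 ∷ 0 ∷ 0 ∷ 1 ∷ 0 ∷ 1 ∷ []) ∷
    (0 ∷ 0 ∷ 0 ∷ 1 ∷ 1 ∷ 0 ∷ 0 ∷ 0 ∷ 1 ∷ 1 ∷ []) ∷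
    (0 ∷ 0 ∷ 0 ∷ 1 ∷ 0 ∷ 1 ∷ 1 ∷ 1 ∷ 0 ∷ 0 ∷ []) ∷
    (0 ∷ 0 ∷ 0 ∷ 1 ∷ 0 ∷ 1 ∷ 1 ∷ 0 ∷ 1 ∷ 0 ∷ []) ∷
    (0 ∷ 0 ∷ 0 ∷ 1 ∷ 0 ∷ 1 ∷ 0 ∷ 1 ∷ 1 ∷ 0 ∷ []) ∷
    (0 ∷ 0 ∷ 0 ∷ 1 ∷ 0 ∷ 1 ∷ 0 ∷ 1 ∷ 0 ∷ 1 ∷ []) ∷
    (0 ∷ 0 ∷ 0 ∷ 1 ∷ 0 ∷ 1 ∷ 0 ∷ 0 ∷ 1 ∷ 1 ∷ []) ∷
    (0 ∷ 0 ∷ 0 ∷ 1 ∷ 0 ∷ 0 ∷ 1 ∷ 1 ∷ 1 ∷ 0 ∷ []) ∷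
    (0 ∷ 0 ∷ 0 ∷ 1 ∷ 0 ∷ 0 ∷ 1 ∷ 1 ∷ 0 ∷ 1 ∷ []) ∷
    (0 ∷ 0 ∷ 0 ∷ 1 ∷ 0 ∷ 0 ∷ 1 ∷ 0 ∷ 1 ∷ 1 ∷ []) ∷ []

  M₄ : Matrix 6
  M₄ = fromRows
    ( (0 ∷ 3 ∷ 3 ∷ 3 ∷ 3 ∷ 4 ∷ [])
    ∷ (3 ∷ 0 ∷ 3 ∷ 3 ∷ 4 ∷ 3 ∷ [])
    ∷ (3 ∷ 3 ∷ 0 ∷ 4 ∷ 3 ∷ 3 ∷ [])
    ∷ (3 ∷ 3 ∷ 4 ∷ 0 ∷ 3 ∷ 3 ∷ [])
    ∷ (3 ∷ 4 ∷ 3 ∷ 3 ∷ 0 ∷ 3 ∷ [])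
    ∷ (4 ∷ 3 ∷ 3 ∷ 3 ∷ 3 ∷ 0 ∷ [])
    ∷ [] )

  -- C⁺₄ − C⁻₄ = 32 M₄⁻¹
  C⁺₄ : Matrix 6
  C⁺₄ = fromRows
    ( (0 ∷ 3 ∷ 3 ∷ 3 ∷ 3 ∷ 0 ∷ [])
    ∷ (3 ∷ 0 ∷ 3 ∷ 3 ∷ 0 ∷ 3 ∷ [])
    ∷ (3 ∷ 3 ∷ 0 ∷ 0 ∷ 3 ∷ 3 ∷ [])
    ∷ (3 ∷ 3 ∷ 0 ∷ 0 ∷ 3 ∷ 3 ∷ [])
    ∷ (3 ∷ 0 ∷ 3 ∷ 3 ∷ 0 ∷ 3 ∷ [])
    ∷ (0 ∷ 3 ∷ 3 ∷ 3 ∷ 3 ∷ 0 ∷ [])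
    ∷ [] )

  C⁻₄ : Matrix 6
  C⁻₄ = fromRows
    ( (9 ∷ 0 ∷ 0 ∷ 0 ∷ 0 ∷ 1 ∷ [])
    ∷ (0 ∷ 9 ∷ 0 ∷ 0 ∷ 1 ∷ 0 ∷ [])
    ∷ (0 ∷ 0 ∷ 9 ∷ 1 ∷ 0 ∷ 0 ∷ [])
    ∷ (0 ∷ 0 ∷ 1 ∷ 9 ∷ 0 ∷ 0 ∷ [])
    ∷ (0 ∷ 1 ∷ 0 ∷ 0 ∷ 9 ∷ 0 ∷ [])
    ∷ (1 ∷ 0 ∷ 0 ∷ 0 ∷ 0 ∷ 9 ∷ [])
    ∷ [] )

  M₅ : Matrix 10
  M₅ = fromRows
    ( ( 0 ∷ 30 ∷ 30 ∷ 30 ∷ 30 ∷ 30 ∷ 30 ∷ 40 ∷ 40 ∷ 40 ∷ [])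
    ∷ (30 ∷  0 ∷ 30 ∷ 30 ∷ 30 ∷ 40 ∷ 40 ∷ 30 ∷ 30 ∷ 40 ∷ [])
    ∷ (30 ∷ 30 ∷  0 ∷ 30 ∷ 40 ∷ 30 ∷ 40 ∷ 30 ∷ 40 ∷ 30 ∷ [])
    ∷ (30 ∷ 30 ∷ 30 ∷  0 ∷ 40 ∷ 40 ∷ 30 ∷ 40 ∷ 30 ∷ 30 ∷ [])
    ∷ (30 ∷ 30 ∷ 40 ∷ 40 ∷  0 ∷ 30 ∷ 30 ∷ 30 ∷ 30 ∷ 40 ∷ [])
    ∷ (30 ∷ 40 ∷ 30 ∷ 40 ∷ 30 ∷  0 ∷ 30 ∷ 30 ∷ 40 ∷ 30 ∷ [])
    ∷ (30 ∷ 40 ∷ 40 ∷ 30 ∷ 30 ∷ 30 ∷  0 ∷ 40 ∷ 30 ∷ 30 ∷ [])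
    ∷ (40 ∷ 30 ∷ 30 ∷ 40 ∷ 30 ∷ 30 ∷ 40 ∷  0 ∷ 30 ∷ 30 ∷ [])
    ∷ (40 ∷ 30 ∷ 40 ∷ 30 ∷ 30 ∷ 40 ∷ 30 ∷ 30 ∷  0 ∷ 30 ∷ [])
    ∷ (40 ∷ 40 ∷ 30 ∷ 30 ∷ 40 ∷ 30 ∷ 30 ∷ 30 ∷ 30 ∷  0 ∷ [])
    ∷ [] )

  -- C⁺₅ − C⁻₅ = 1500 M₅⁻¹
  C⁺₅ : Matrix 10
  C⁺₅ = fromRows
    ( ( 0 ∷ 11 ∷ 11 ∷ 11 ∷ 11 ∷ 11 ∷ 11 ∷  0 ∷  0 ∷  0 ∷ [])
    ∷ (11 ∷  0 ∷ 11 ∷ 11 ∷ 11 ∷  0 ∷  0 ∷ 11 ∷ 11 ∷  0 ∷ [])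
    ∷ (11 ∷ 11 ∷  0 ∷ 11 ∷  0 ∷ 11 ∷  0 ∷ 11 ∷  0 ∷ 11 ∷ [])
    ∷ (11 ∷ 11 ∷ 11 ∷  0 ∷  0 ∷  0 ∷ 11 ∷  0 ∷ 11 ∷ 11 ∷ [])
    ∷ (11 ∷ 11 ∷  0 ∷  0 ∷  0 ∷ 11 ∷ 11 ∷ 11 ∷ 11 ∷  0 ∷ [])
    ∷ (11 ∷  0 ∷ 11 ∷  0 ∷ 11 ∷  0 ∷ 11 ∷ 11 ∷  0 ∷ 11 ∷ [])
    ∷ (11 ∷  0 ∷  0 ∷ 11 ∷ 11 ∷ 11 ∷  0 ∷  0 ∷ 11 ∷ 11 ∷ [])
    ∷ ( 0 ∷ 11 ∷ 11 ∷  0 ∷ 11 ∷ 11 ∷  0 ∷  0 ∷ 11 ∷ 11 ∷ [])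
    ∷ ( 0 ∷ 11 ∷  0 ∷ 11 ∷ 11 ∷  0 ∷ 11 ∷ 11 ∷  0 ∷ 11 ∷ [])
    ∷ ( 0 ∷  0 ∷ 11 ∷ 11 ∷  0 ∷ 11 ∷ 11 ∷ 11 ∷ 11 ∷  0 ∷ [])
    ∷ [] )

  C⁻₅ : Matrix 10
  C⁻₅ = fromRows
    ( (49 ∷  0 ∷  0 ∷  0 ∷  0 ∷  0 ∷  0 ∷  4 ∷  4 ∷  4 ∷ [])
    ∷ ( 0 ∷ 49 ∷  0 ∷  0 ∷  0 ∷  4 ∷  4 ∷  0 ∷  0 ∷  4 ∷ [])
    ∷ ( 0 ∷  0 ∷ 49 ∷  0 ∷  4 ∷  0 ∷  4 ∷  0 ∷  4 ∷  0 ∷ [])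
    ∷ ( 0 ∷  0 ∷  0 ∷ 49 ∷  4 ∷  4 ∷  0 ∷  4 ∷  0 ∷  0 ∷ [])
    ∷ ( 0 ∷  0 ∷  4 ∷  4 ∷ 49 ∷  0 ∷  0 ∷  0 ∷  0 ∷  4 ∷ [])
    ∷ ( 0 ∷  4 ∷  0 ∷  4 ∷  0 ∷ 49 ∷  0 ∷  0 ∷  4 ∷  0 ∷ [])
    ∷ ( 0 ∷  4 ∷  4 ∷  0 ∷  0 ∷  0 ∷ 49 ∷  4 ∷  0 ∷  0 ∷ [])
    ∷ ( 4 ∷  0 ∷  0 ∷  4 ∷  0 ∷  0 ∷  4 ∷ 49 ∷  0 ∷  0 ∷ [])
    ∷ ( 4 ∷  0 ∷  4 ∷  0 ∷  0 ∷  4 ∷  0 ∷  0 ∷ 49 ∷  0 ∷ [])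
    ∷ ( 4 ∷  4 ∷  0 ∷  0 ∷  4 ∷  0 ∷  0 ∷  0 ∷  0 ∷ 49 ∷ [])
    ∷ [] )

  -- The entries 1, 6, 96, 3000 of the degree-0 pairings are s! times the number nⁿ⁻² of spanning
  -- trees of Kₙ, s = n − 1.
  K₁-certificate : KirchhoffCertificate (Kn 1)
  K₁-certificate = record
    { trees = K₁-trees ; trees-correct = refl ; tree = []
    ; evidence = λ where
        0       _    → middle refl
        (suc k) 2k≤0 → contradiction (2*[m+n]≤o⇒2*m≤o 1 k 2k≤0) λ ()
    }

  K₂-certificate : KirchhoffCertificate (Kn 2)
  K₂-certificate = record
    { trees = K₂-trees ; trees-correct = refl ; tree = 1 ∷ []
    ; evidence = λ where
        0       _    → gramEvidence constants (λ _ _ → 1) (unitCertificate 1)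
        (suc k) 2k≤1 → contradiction (2*[m+n]≤o⇒2*m≤o 1 k 2k≤1) λ { (s≤s ()) }
    }

  K₃-certificate : KirchhoffCertificate (Kn 3)
  K₃-certificate = record
    { trees = K₃-trees ; trees-correct = refl ; tree = 1 ∷ 1 ∷ 0 ∷ []
    ; evidence = λ where
        0             _    → gramEvidence constants (λ _ _ → 6) (unitCertificate 6)
        1             _    → middle refl
        (suc (suc k)) 2k≤2 → contradiction (2*[m+n]≤o⇒2*m≤o 2 k 2k≤2) λ { (s≤s (s≤s ())) }
    }

  K₄-certificate : KirchhoffCertificate (Kn 4)
  K₄-certificate = record
    { trees = K₄-trees ; trees-correct = refl ; tree = 1 ∷ 1 ∷ 1 ∷ 0 ∷ 0 ∷ 0 ∷ []
    ; evidence = λ where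
        0             _    → gramEvidence constants (λ _ _ → 96) (unitCertificate 96)
        1             _    → gramEvidence variables M₄ (inverseCertificate M₄ 31 C⁺₄ C⁻₄)
        (suc (suc k)) 2k≤3 → contradiction (2*[m+n]≤o⇒2*m≤o 2 k 2k≤3) λ { (s≤s (s≤s (s≤s ()))) }
    }

  K₅-certificate : KirchhoffCertificate (Kn 5)
  K₅-certificate = record
    { trees = K₅-trees ; trees-correct = refl ; tree = 1 ∷ 1 ∷ 1 ∷ 1 ∷ 0 ∷ 0 ∷ 0 ∷ 0 ∷ 0 ∷ 0 ∷ []
    ; evidence = λ where
        0                   _    → gramEvidence constants (λ _ _ → 3000) (unitCertificate 3000)
        1                   _    → gramEvidence variables M₅ (inverseCertificate M₅ 1499 C⁺₅ C⁻₅)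
        2                   _    → middle refl
        (suc (suc (suc k))) 2k≤4 → contradiction (2*[m+n]≤o⇒2*m≤o 3 k 2k≤4) λ { (s≤s (s≤s (s≤s (s≤s ())))) }
    }

  Kn-certificate : ∀ n → 1 ≤ n → n ≤ 5 → KirchhoffCertificate (Kn n)
  Kn-certificate 1 _ _ = K₁-certificate
  Kn-certificate 2 _ _ = K₂-certificate
  Kn-certificate 3 _ _ = K₃-certificate
  Kn-certificate 4 _ _ = K₄-certificate
  Kn-certificate 5 _ _ = K₅-certificate
  Kn-certificate (suc (suc (suc (suc (suc (suc _)))))) _ (s≤s (s≤s (s≤s (s≤s (s≤s ())))))

open CompleteGraphs

module _ {c ℓ} (K : Field c ℓ) (charZero : CharZero K) where
  open Field K using (_≈_)
  open MatrixAction K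
  open Differentiation K
  open Lefschetz K

  coeff-kirchhoff : ∀ G β → Poly.coeff K (nEdges G) (kirchhoff K G) β ≈ ⟦ multiplicity (spanningTreeExponents G) β ⟧
  coeff-kirchhoff G = coeff-monomials indicator (spanningTrees G)

  kirchhoff-isStrongLefschetzElement : ∀ G → KirchhoffCertificate G →
    Poly.IsStrongLefschetzElement K (nEdges G) (kirchhoff K G) (Poly.sumVars K (nEdges G))
  kirchhoff-isStrongLefschetzElement G cert = sumVars-isStrongLefschetzElement tree evidence
    where
    open KirchhoffCertificate cert
    F≈f : ∀ β → Poly.coeff K (nEdges G) (kirchhoff K G) β ≈ ⟦ multiplicity trees β ⟧
    F≈f = subst (λ ts → ∀ β → Poly.coeff K (nEdges G) (kirchhoff K G) β ≈ ⟦ multiplicity ts β ⟧)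
                trees-correct (coeff-kirchhoff G)
    deg-trees : All (λ α → deg α ≡ Graph.V G ∸ 1) trees
    deg-trees = subst (All _) trees-correct (spanningTreeExponents-deg G)
    open NaturalCoefficients charZero (kirchhoff K G) (multiplicity trees) F≈f (multiplicity-vanish trees deg-trees)

theorem4p5 : ∀ {c ℓ : Level} (K : Field c ℓ) → CharZero K →
    ∀ (n : ℕ) → 1 ≤ n → n ≤ 5 →
      Poly.HasStrongLefschetzProperty K (nEdges (Kn n)) (kirchhoff K (Kn n)) ×
      Poly.IsStrongLefschetzElement K (nEdges (Kn n)) (kirchhoff K (Kn n))
        (Poly.sumVars K (nEdges (Kn n)))
theorem4p5 K charZero n 1≤n n≤5 = (Poly.sumVars K (nEdges (Kn n)) , sumVars-SLE) , sumVars-SLE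
  where
  sumVars-SLE : Poly.IsStrongLefschetzElement K (nEdges (Kn n)) (kirchhoff K (Kn n)) (Poly.sumVars K (nEdges (Kn n)))
  sumVars-SLE = kirchhoff-isStrongLefschetzElement K charZero (Kn n) (Kn-certificate n 1≤n n≤5)
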